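{- Let $\mathbf a$ and $\mathbf b$ be arbitrary nonempty compositions. Then: (1) if $\mathbf c\in\{(4,3,2),(4,3,4),(3,2,3,2),(3,3,2,3,2)\}$, the composition $\mathbf c\oplus\mathbf b$ is not maximal; (2) if $\mathbf c\in\{(2,3,3),(4,3,3),(2,3,2,2),(2,3,2,3,2)\}$, the composition $\mathbf a\oplus\mathbf c$ is not maximal.
   Context: Permutations $\sigma\in\mathcal S_n$ are words $\sigma_1\cdots\sigma_n$; $i$ is a peak if $\sigma_{i-1}<\sigma_i>\sigma_{i+1}$. A composition of $n$ is a finite sequence of positive integers summing to $n$. If the peak set of $\sigma\in\mathcal S_n$ is $\{i_1<\dots<i_k\}$, its peak-composition is $(c_1,\dots,c_{k+1})$, $c_j=i_j-i_{j-1}$, $i_0=0$, $i_{k+1}=n$. $\mathrm P(\mathbf c)$ is the number of $\sigma\in\mathcal S_n$ with peak-composition $\mathbf c$; $\mathbf c$ is maximal if $\mathrm P(\mathbf b)\le\mathrm P(\mathbf c)$ for every composition $\mathbf b$ of the same size. $\oplus$ denotes concatenation of compositions. -}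

module Defs where

open import Data.Nat using (ℕ; zero; suc; _+_; _∸_; _<_; _≤_; _<?_)
open import Data.Bool using (Bool; true; false; _∧_; if_then_else_)
open import Data.List using (List; []; _∷_; [_]; map; concatMap; upTo; length; filter)
open import Data.Nat.ListAction using (sum)
open import Data.List.Properties using (≡-dec)
open import Data.List.Relation.Unary.All using (All)
import Data.Nat as ℕ
open import Relation.Nullary using (does)
open import Relation.Binary.PropositionalEquality using (_≡_)

IsComposition : List ℕ → Set
IsComposition c = All (λ x → 0 < x) c

insertions : ℕ → List ℕ → List (List ℕ)
insertions x [] = [ x ∷ [] ]
insertions x (y ∷ ys) = (x ∷ y ∷ ys) ∷ map (y ∷_) (insertions x ys)

perms : List ℕ → List (List ℕ)
perms [] = [ [] ]
perms (x ∷ xs) = concatMap (insertions x) (perms xs)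

-- S_n : all permutations of 1..n, as words σ₁⋯σₙ (each exactly once).
Sym : ℕ → List (List ℕ)
Sym n = perms (map suc (upTo n))

-- Peak positions (1-indexed): i is a peak iff σ_{i-1} < σ_i > σ_{i+1}.
-- peaksFrom i w : the first letter of w is at position i.
peaksFrom : ℕ → List ℕ → List ℕ
peaksFrom i (x ∷ y ∷ z ∷ rest) =
  (if does (x <? y) ∧ does (z <? y) then suc i ∷_ else (λ l → l))
    (peaksFrom (suc i) (y ∷ z ∷ rest))
peaksFrom i _ = []

peakSet : List ℕ → List ℕ
peakSet σ = peaksFrom 1 σ

diffs : ℕ → List ℕ → ℕ → List ℕ
diffs prev [] n = [ n ∸ prev ]
diffs prev (p ∷ ps) n = (p ∸ prev) ∷ diffs p ps n

-- peak-composition (c₁,…,c_{k+1}), c_j = i_j − i_{j−1}, i₀ = 0, i_{k+1} = n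
peakComp : List ℕ → List ℕ
peakComp σ = diffs 0 (peakSet σ) (length σ)

P : List ℕ → ℕ
P c = length (filter (λ σ → ≡-dec ℕ._≟_ (peakComp σ) c) (Sym (sum c)))

Maximal : List ℕ → Set
Maximal c = (b : List ℕ) → IsComposition b → sum b ≡ sum c → P b ≤ P c

module Submission where

-- For each listed c we name a replacement c' of the same size and prove
-- P(c ⊕ b) ≼ P(c' ⊕ b), resp. P(a ⊕ c) ≼ P(a ⊕ c'), where x ≼ y means x ≤ y with
-- strict inequality as soon as x > 0.  This excludes maximality: if P(c ⊕ b) > 0 the
-- inequality is strict, and if it vanishes the one-part composition (n) does better.
--
-- For the prefix case write σ = π y τ with |π| = |c| and group the permutations by the
-- set V of letters of π (a "fiber", `fiber-comparison-prefix`).  Inside a fiber the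
-- indicator of "peak composition c ⊕ b" factors at the peak |c| into a factor that only
-- depends on y τ and the indicator that π y has peak set {c₁, c₁+c₂, …, |c|}
-- (`peakComp-split`); summed over the orders π of V the latter depends only on the rank
-- of y in V.  The dependence on ranks is computed by a dynamic program over relative
-- ranks (`arrangements-by-rank`), so the comparison of two fibers becomes a finite
-- table comparison, decided by evaluation.  The suffix case is symmetric, with the fiber
-- formed by the last |c| + 1 letters.

open import Defs
open import Data.Bool using (Bool; true; false; if_then_else_; not; _∧_; _∨_; T)
open import Data.Bool.Properties using (∧-zeroʳ; T-∧)
open import Data.Empty using (⊥; ⊥-elim)
open import Data.List using (List; []; _∷_; _++_; [_]; map; concatMap; length; filter; drop; upTo; applyUpTo; initLast; _∷ʳ′_)
open import Data.List.Membership.Propositional using (_∈_)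
open import Data.List.Properties
  using (≡-dec; ++-assoc; length-++; ++-identityʳ; ++-cancelˡ; ∷-injectiveˡ; ∷-injectiveʳ; ∷ʳ-injectiveˡ;
         map-++; map-∘; map-cong; map-cong-local; map-applyUpTo; length-applyUpTo)
open import Data.List.Relation.Unary.All using (All; []; _∷_)
import Data.List.Relation.Unary.All as All
import Data.List.Relation.Unary.All.Properties as AllP
import Data.List.Relation.Unary.Any as Any
open import Data.Nat using (ℕ; zero; suc; pred; >-nonZero; _+_; _*_; _∸_; _≤_; _<_; _<?_; z≤n; s≤s; _≡ᵇ_; _≤ᵇ_; _<ᵇ_)
import Data.Nat as ℕ
open import Data.Nat.ListAction using (sum)
open import Data.Nat.ListAction.Properties using (sum-++)
open import Data.Nat.Properties
open import Algebra.Properties.CommutativeSemigroup +-commutativeSemigroup using (interchange)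
open import Data.Product using (_×_; _,_; proj₁; Σ-syntax)
open import Data.Sum using (inj₁; inj₂)
open import Function.Bundles using (module Equivalence)
open import Data.Unit using (⊤; tt)
open import Relation.Nullary using (Dec; yes; no; does; ¬_)
open import Relation.Binary.PropositionalEquality
  using (_≡_; _≢_; refl; sym; trans; cong; cong₂; subst; subst₂; module ≡-Reasoning)

𝟙 : ∀ {a} {A : Set a} → Dec A → ℕ
𝟙 (yes _) = 1
𝟙 (no _) = 0

bit : Bool → ℕ
bit true = 1
bit false = 0

δ : List ℕ → List ℕ → ℕ
δ xs ys = 𝟙 (≡-dec ℕ._≟_ xs ys)

δ-≡ : ∀ {xs ys} → xs ≡ ys → δ xs ys ≡ 1
δ-≡ {xs} {ys} e with ≡-dec ℕ._≟_ xs ys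
... | yes _ = refl
... | no xs≢ys = ⊥-elim (xs≢ys e)

δ-≢ : ∀ {xs ys} → xs ≢ ys → δ xs ys ≡ 0
δ-≢ {xs} {ys} xs≢ys with ≡-dec ℕ._≟_ xs ys
... | yes e = ⊥-elim (xs≢ys e)
... | no _ = refl

δ-⇔ : ∀ {xs ys xs' ys'} → (xs ≡ ys → xs' ≡ ys') → (xs' ≡ ys' → xs ≡ ys) → δ xs ys ≡ δ xs' ys'
δ-⇔ {xs} {ys} to from with ≡-dec ℕ._≟_ xs ys
... | yes e = sym (δ-≡ (to e))
... | no ne = sym (δ-≢ (λ e → ne (from e)))

δ-++ˡ : ∀ c xs ys → δ (c ++ xs) (c ++ ys) ≡ δ xs ys
δ-++ˡ c xs ys = δ-⇔ (++-cancelˡ c xs ys) (cong (c ++_))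

δ-∷ʳ : ∀ xs ys s → δ (xs ++ [ s ]) (ys ++ [ s ]) ≡ δ xs ys
δ-∷ʳ xs ys s = δ-⇔ (∷ʳ-injectiveˡ xs ys) (cong (_++ [ s ]))

T⇒≡true : ∀ {b} → T b → b ≡ true
T⇒≡true {true} _ = refl

¬T⇒≡false : ∀ {b} → ¬ T b → b ≡ false
¬T⇒≡false {true} f = ⊥-elim (f tt)
¬T⇒≡false {false} _ = refl

δ-∷ : ∀ p q xs ys → δ (p ∷ xs) (q ∷ ys) ≡ (if p ≡ᵇ q then δ xs ys else 0)
δ-∷ p q xs ys = by-cases (p ℕ.≟ q)
  where
  select : ∀ {b} → b ≡ (p ≡ᵇ q) → ∀ n → (if b then n else 0) ≡ (if p ≡ᵇ q then n else 0)
  select e n = cong (λ b → if b then n else 0) e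
  by-cases : Dec (p ≡ q) → δ (p ∷ xs) (q ∷ ys) ≡ (if p ≡ᵇ q then δ xs ys else 0)
  by-cases (yes refl) = trans (δ-⇔ ∷-injectiveʳ (cong (p ∷_))) (select (sym (T⇒≡true (≡⇒≡ᵇ p p refl))) (δ xs ys))
  by-cases (no p≢q) = trans (δ-≢ (λ e → p≢q (∷-injectiveˡ e))) (select (sym (¬T⇒≡false (λ t → p≢q (≡ᵇ⇒≡ p q t)))) (δ xs ys))

sum-map-+ : ∀ {A : Set} (f g : A → ℕ) xs → sum (map (λ x → f x + g x) xs) ≡ sum (map f xs) + sum (map g xs)
sum-map-+ f g [] = refl
sum-map-+ f g (x ∷ xs) = trans (cong (f x + g x +_) (sum-map-+ f g xs)) (interchange (f x) (g x) _ _)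

sum-map-* : ∀ {A : Set} t (f : A → ℕ) xs → sum (map (λ x → t * f x) xs) ≡ t * sum (map f xs)
sum-map-* t f [] = sym (*-zeroʳ t)
sum-map-* t f (x ∷ xs) = trans (cong (t * f x +_) (sum-map-* t f xs)) (sym (*-distribˡ-+ t (f x) _))

sum-map-0 : ∀ {A : Set} (xs : List A) → sum (map (λ _ → 0) xs) ≡ 0
sum-map-0 [] = refl
sum-map-0 (_ ∷ xs) = sum-map-0 xs

sum-map-++ : ∀ {A : Set} (f : A → ℕ) xs ys → sum (map f (xs ++ ys)) ≡ sum (map f xs) + sum (map f ys)
sum-map-++ f xs ys = trans (cong sum (map-++ f xs ys)) (sum-++ (map f xs) (map f ys))

sum-map-concatMap : ∀ {A B : Set} (f : B → ℕ) (g : A → List B) xs →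
  sum (map f (concatMap g xs)) ≡ sum (map (λ x → sum (map f (g x))) xs)
sum-map-concatMap f g [] = refl
sum-map-concatMap f g (x ∷ xs) =
  trans (sum-map-++ f (g x) (concatMap g xs)) (cong (sum (map f (g x)) +_) (sum-map-concatMap f g xs))

ΣPerm : List ℕ → (List ℕ → ℕ) → ℕ
ΣPerm L f = sum (map f (perms L))

ΣPerm-cong : ∀ L {f g : List ℕ → ℕ} → (∀ σ → f σ ≡ g σ) → ΣPerm L f ≡ ΣPerm L g
ΣPerm-cong L f≗g = cong sum (map-cong f≗g (perms L))

ΣPerm-+ : ∀ L (f g : List ℕ → ℕ) → ΣPerm L (λ σ → f σ + g σ) ≡ ΣPerm L f + ΣPerm L g
ΣPerm-+ L f g = sum-map-+ f g (perms L)

ΣPerm-* : ∀ L t (f : List ℕ → ℕ) → ΣPerm L (λ σ → t * f σ) ≡ t * ΣPerm L f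
ΣPerm-* L t f = sum-map-* t f (perms L)

ΣPerm-0 : ∀ L → ΣPerm L (λ _ → 0) ≡ 0
ΣPerm-0 L = sum-map-0 (perms L)

ΣIns : ℕ → (List ℕ → ℕ) → List ℕ → ℕ
ΣIns y f τ = sum (map f (insertions y τ))

ΣPerm-∷ : ∀ y ys f → ΣPerm (y ∷ ys) f ≡ ΣPerm ys (ΣIns y f)
ΣPerm-∷ y ys f = sum-map-concatMap f (insertions y) (perms ys)

data Pick : List ℕ → ℕ → List ℕ → ℕ → Set where
  here : ∀ {v V} → Pick (v ∷ V) 0 V v
  there : ∀ {v V i R z} → Pick V i R z → Pick (v ∷ V) (suc i) (v ∷ R) z

ΣPick : List ℕ → (List ℕ → ℕ → ℕ) → ℕ
ΣPick [] F = 0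
ΣPick (v ∷ V) F = F V v + ΣPick V (λ R z → F (v ∷ R) z)

ΣPick-cong : ∀ V {F G : List ℕ → ℕ → ℕ} → (∀ {i R z} → Pick V i R z → F R z ≡ G R z) → ΣPick V F ≡ ΣPick V G
ΣPick-cong [] h = refl
ΣPick-cong (v ∷ V) h = cong₂ _+_ (h here) (ΣPick-cong V (λ p → h (there p)))

ΣPick-+ : ∀ V (F G : List ℕ → ℕ → ℕ) → ΣPick V (λ R z → F R z + G R z) ≡ ΣPick V F + ΣPick V G
ΣPick-+ [] F G = refl
ΣPick-+ (v ∷ V) F G =
  trans (cong (F V v + G V v +_) (ΣPick-+ V (λ R z → F (v ∷ R) z) (λ R z → G (v ∷ R) z))) (interchange (F V v) (G V v) _ _)

ΣPick-* : ∀ V t (F : List ℕ → ℕ → ℕ) → ΣPick V (λ R z → t * F R z) ≡ t * ΣPick V F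
ΣPick-* [] t F = sym (*-zeroʳ t)
ΣPick-* (v ∷ V) t F = trans (cong (t * F V v +_) (ΣPick-* V t _)) (sym (*-distribˡ-+ t (F V v) _))

ΣPerm-byFirst : ∀ y ys f → ΣPerm (y ∷ ys) f ≡ ΣPick (y ∷ ys) (λ R z → ΣPerm R (λ σ → f (z ∷ σ)))
ΣPerm-byFirst y [] f = sym (+-identityʳ _)
ΣPerm-byFirst y (z ∷ zs) f = begin
    ΣPerm (y ∷ z ∷ zs) f
  ≡⟨ ΣPerm-∷ y (z ∷ zs) f ⟩
    ΣPerm (z ∷ zs) (ΣIns y f)
  ≡⟨ ΣPerm-byFirst z zs (ΣIns y f) ⟩
    ΣPick (z ∷ zs) (λ R w → ΣPerm R (λ σ → ΣIns y f (w ∷ σ)))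
  ≡⟨ ΣPick-cong (z ∷ zs) (λ {_} {R} {w} _ → insert-behind R w) ⟩
    ΣPick (z ∷ zs) (λ R w → ΣPerm R (λ σ → f (y ∷ w ∷ σ)) + ΣPerm (y ∷ R) (λ σ → f (w ∷ σ)))
  ≡⟨ ΣPick-+ (z ∷ zs) (λ R w → ΣPerm R (λ σ → f (y ∷ w ∷ σ))) (λ R w → ΣPerm (y ∷ R) (λ σ → f (w ∷ σ))) ⟩
    ΣPick (z ∷ zs) (λ R w → ΣPerm R (λ σ → f (y ∷ w ∷ σ))) + ΣPick (z ∷ zs) (λ R w → ΣPerm (y ∷ R) (λ σ → f (w ∷ σ)))
  ≡⟨ cong (_+ ΣPick (z ∷ zs) (λ R w → ΣPerm (y ∷ R) (λ σ → f (w ∷ σ)))) (sym (ΣPerm-byFirst z zs (λ τ → f (y ∷ τ)))) ⟩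
    ΣPerm (z ∷ zs) (λ τ → f (y ∷ τ)) + ΣPick (z ∷ zs) (λ R w → ΣPerm (y ∷ R) (λ σ → f (w ∷ σ)))
  ∎
  where
  open ≡-Reasoning
  -- inserting y into w ∷ σ: either in front of w, or somewhere behind it
  insert-behind : ∀ R w → ΣPerm R (λ σ → ΣIns y f (w ∷ σ)) ≡ ΣPerm R (λ σ → f (y ∷ w ∷ σ)) + ΣPerm (y ∷ R) (λ σ → f (w ∷ σ))
  insert-behind R w = begin
      ΣPerm R (λ σ → ΣIns y f (w ∷ σ))
    ≡⟨ ΣPerm-cong R (λ σ → cong (f (y ∷ w ∷ σ) +_) (cong sum (sym (map-∘ (insertions y σ))))) ⟩
      ΣPerm R (λ σ → f (y ∷ w ∷ σ) + ΣIns y (λ τ → f (w ∷ τ)) σ)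
    ≡⟨ ΣPerm-+ R _ _ ⟩
      ΣPerm R (λ σ → f (y ∷ w ∷ σ)) + ΣPerm R (ΣIns y (λ τ → f (w ∷ τ)))
    ≡⟨ cong (ΣPerm R (λ σ → f (y ∷ w ∷ σ)) +_) (sym (ΣPerm-∷ y R (λ σ → f (w ∷ σ)))) ⟩
      ΣPerm R (λ σ → f (y ∷ w ∷ σ)) + ΣPerm (y ∷ R) (λ σ → f (w ∷ σ))
    ∎

insertions-∷ʳ : ∀ y (σ : List ℕ) w →
  insertions y (σ ++ [ w ]) ≡ map (_++ [ w ]) (insertions y σ) ++ [ (σ ++ [ w ]) ++ [ y ] ]
insertions-∷ʳ y [] w = refl
insertions-∷ʳ y (x ∷ σ) w rewrite insertions-∷ʳ y σ w = cong ((y ∷ x ∷ σ ++ [ w ]) ∷_)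
  (trans (map-++ (x ∷_) (map (_++ [ w ]) (insertions y σ)) _)
    (cong (_++ [ x ∷ (σ ++ [ w ]) ++ [ y ] ])
      (trans (sym (map-∘ (insertions y σ))) (map-∘ (insertions y σ)))))

ΣPerm-byLast : ∀ y ys f → ΣPerm (y ∷ ys) f ≡ ΣPick (y ∷ ys) (λ R z → ΣPerm R (λ σ → f (σ ++ [ z ])))
ΣPerm-byLast y [] f = sym (+-identityʳ _)
ΣPerm-byLast y (z ∷ zs) f = begin
    ΣPerm (y ∷ z ∷ zs) f
  ≡⟨ ΣPerm-∷ y (z ∷ zs) f ⟩
    ΣPerm (z ∷ zs) (ΣIns y f)
  ≡⟨ ΣPerm-byLast z zs (ΣIns y f) ⟩
    ΣPick (z ∷ zs) (λ R w → ΣPerm R (λ σ → ΣIns y f (σ ++ [ w ])))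
  ≡⟨ ΣPick-cong (z ∷ zs) (λ {_} {R} {w} _ → insert-before R w) ⟩
    ΣPick (z ∷ zs) (λ R w → ΣPerm (y ∷ R) (λ σ → f (σ ++ [ w ])) + ΣPerm R (λ σ → f ((σ ++ [ w ]) ++ [ y ])))
  ≡⟨ ΣPick-+ (z ∷ zs) (λ R w → ΣPerm (y ∷ R) (λ σ → f (σ ++ [ w ]))) (λ R w → ΣPerm R (λ σ → f ((σ ++ [ w ]) ++ [ y ]))) ⟩
    ΣPick (z ∷ zs) (λ R w → ΣPerm (y ∷ R) (λ σ → f (σ ++ [ w ]))) + ΣPick (z ∷ zs) (λ R w → ΣPerm R (λ σ → f ((σ ++ [ w ]) ++ [ y ])))
  ≡⟨ cong (ΣPick (z ∷ zs) (λ R w → ΣPerm (y ∷ R) (λ σ → f (σ ++ [ w ]))) +_) (sym (ΣPerm-byLast z zs (λ τ → f (τ ++ [ y ])))) ⟩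
    ΣPick (z ∷ zs) (λ R w → ΣPerm (y ∷ R) (λ σ → f (σ ++ [ w ]))) + ΣPerm (z ∷ zs) (λ τ → f (τ ++ [ y ]))
  ≡⟨ +-comm _ (ΣPerm (z ∷ zs) (λ τ → f (τ ++ [ y ]))) ⟩
    ΣPerm (z ∷ zs) (λ τ → f (τ ++ [ y ])) + ΣPick (z ∷ zs) (λ R w → ΣPerm (y ∷ R) (λ σ → f (σ ++ [ w ])))
  ∎
  where
  open ≡-Reasoning
  -- inserting y into σ ++ [ w ]: somewhere before w, or behind it
  insert-before : ∀ R w → ΣPerm R (λ σ → ΣIns y f (σ ++ [ w ])) ≡
    ΣPerm (y ∷ R) (λ σ → f (σ ++ [ w ])) + ΣPerm R (λ σ → f ((σ ++ [ w ]) ++ [ y ]))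
  insert-before R w = begin
      ΣPerm R (λ σ → ΣIns y f (σ ++ [ w ]))
    ≡⟨ ΣPerm-cong R split ⟩
      ΣPerm R (λ σ → ΣIns y (λ τ → f (τ ++ [ w ])) σ + f ((σ ++ [ w ]) ++ [ y ]))
    ≡⟨ ΣPerm-+ R _ _ ⟩
      ΣPerm R (ΣIns y (λ τ → f (τ ++ [ w ]))) + ΣPerm R (λ σ → f ((σ ++ [ w ]) ++ [ y ]))
    ≡⟨ cong (_+ ΣPerm R (λ σ → f ((σ ++ [ w ]) ++ [ y ]))) (sym (ΣPerm-∷ y R (λ σ → f (σ ++ [ w ])))) ⟩
      ΣPerm (y ∷ R) (λ σ → f (σ ++ [ w ])) + ΣPerm R (λ σ → f ((σ ++ [ w ]) ++ [ y ]))
    ∎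
    where
    split : ∀ σ → ΣIns y f (σ ++ [ w ]) ≡ ΣIns y (λ τ → f (τ ++ [ w ])) σ + f ((σ ++ [ w ]) ++ [ y ])
    split σ rewrite insertions-∷ʳ y σ w
      | sum-map-++ f (map (_++ [ w ]) (insertions y σ)) [ (σ ++ [ w ]) ++ [ y ] ]
      | sym (map-∘ {g = f} {f = _++ [ w ]} (insertions y σ)) = cong (ΣIns y (λ τ → f (τ ++ [ w ])) σ +_) (+-identityʳ _)

-- Boolean comparison, the same test as in the definition of peaks.
lt : ℕ → ℕ → Bool
lt a b = does (a <? b)

lt-true : ∀ {a b} → a < b → lt a b ≡ true
lt-true p = T⇒≡true (<⇒<ᵇ p)

lt-false : ∀ {a b} → ¬ a < b → lt a b ≡ false
lt-false {a} {b} p = ¬T⇒≡false (λ t → p (<ᵇ⇒< a b t))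

lt-true⁻ : ∀ {a b} → lt a b ≡ true → a < b
lt-true⁻ {a} {b} e = <ᵇ⇒< a b (subst T (sym e) tt)

lt-false⁻ : ∀ {a b} → lt a b ≡ false → ¬ a < b
lt-false⁻ e p with trans (sym e) (lt-true p)
... | ()

lt-asym : ∀ {a b} → lt a b ≡ true → lt b a ≡ false
lt-asym {a} {b} e = lt-false {b} {a} (<-asym (lt-true⁻ {a} {b} e))

≮∧≢⇒> : ∀ {v w} → v ≢ w → ¬ v < w → w < v
≮∧≢⇒> v≢w v≮w = ≤∧≢⇒< (≮⇒≥ v≮w) (λ e → v≢w (sym e))

lt-flip : ∀ {a b} → a ≢ b → lt b a ≡ not (lt a b)
lt-flip {a} {b} a≢b with lt a b in e
... | true = lt-asym {a} {b} e
... | false = lt-true (≮∧≢⇒> a≢b (lt-false⁻ {a} {b} e))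

Increasing : ℕ → List ℕ → Set
Increasing lo [] = ⊤
Increasing lo (v ∷ V) = lo ≤ v × Increasing (suc v) V

NotIn : ℕ → List ℕ → Set
NotIn w V = All (λ v → v ≢ w) V

rank : List ℕ → ℕ → ℕ
rank [] w = 0
rank (v ∷ V) w = if lt v w then suc (rank V w) else rank V w

Increasing-weaken : ∀ {lo lo'} V → lo' ≤ lo → Increasing lo V → Increasing lo' V
Increasing-weaken [] _ _ = tt
Increasing-weaken (v ∷ V) le (p , q) = ≤-trans le p , q

Increasing-NotIn : ∀ {lo} V w → w < lo → Increasing lo V → NotIn w V
Increasing-NotIn [] w _ _ = []
Increasing-NotIn (v ∷ V) w w<lo (p , q) =
  (λ e → <-irrefl (sym e) (<-≤-trans w<lo p)) ∷ Increasing-NotIn V w (<-trans w<lo (s≤s p)) q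

rank-below : ∀ {lo} V w → w < lo → Increasing lo V → rank V w ≡ 0
rank-below [] w _ _ = refl
rank-below (v ∷ V) w w<lo (p , q) with lt v w in e
... | true = ⊥-elim (<-irrefl refl (<-trans (lt-true⁻ e) (<-≤-trans w<lo p)))
... | false = rank-below V w (<-trans w<lo (s≤s p)) q

rank-≤-length : ∀ V w → rank V w ≤ length V
rank-≤-length [] w = z≤n
rank-≤-length (v ∷ V) w with lt v w
... | true = s≤s (rank-≤-length V w)
... | false = m≤n⇒m≤1+n (rank-≤-length V w)

pick-length : ∀ {V i R z} → Pick V i R z → length V ≡ suc (length R)
pick-length here = refl
pick-length (there p) = cong suc (pick-length p)

pick-All : ∀ {Q : ℕ → Set} {V i R z} → Pick V i R z → All Q V → All Q R
pick-All here (_ ∷ qs) = qs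
pick-All (there p) (q ∷ qs) = q ∷ pick-All p qs

pick-elem : ∀ {Q : ℕ → Set} {V i R z} → Pick V i R z → All Q V → Q z
pick-elem here (q ∷ _) = q
pick-elem (there p) (_ ∷ qs) = pick-elem p qs

pick-≢ : ∀ {V i R z w} → Pick V i R z → NotIn w V → z ≢ w
pick-≢ p = pick-elem p

pick-lower : ∀ {V i R z lo} → Pick V i R z → Increasing lo V → lo ≤ z
pick-lower here (p , _) = p
pick-lower (there s) (p , q) = ≤-trans (≤-trans p (n≤1+n _)) (pick-lower s q)

pick-Increasing : ∀ {V i R z lo} → Pick V i R z → Increasing lo V → Increasing lo R
pick-Increasing {v ∷ V} here (p , q) = Increasing-weaken V (≤-trans p (n≤1+n _)) q
pick-Increasing (there s) (p , q) = p , pick-Increasing s q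

pick-fresh : ∀ {V i R z lo} → Pick V i R z → Increasing lo V → NotIn z R
pick-fresh {v ∷ V} here (p , q) = Increasing-NotIn V v ≤-refl q
pick-fresh (there s) (p , q) = (λ e → <-irrefl e (pick-lower s q)) ∷ pick-fresh s q

rank-picked : ∀ {V i R z lo} → Pick V i R z → Increasing lo V → rank R z ≡ i
rank-picked {v ∷ V} here (p , q) = rank-below V v ≤-refl q
rank-picked {v ∷ V} {z = z} (there s) (p , q) with lt v z in e
... | true = cong suc (rank-picked s q)
... | false = ⊥-elim (lt-false⁻ e (pick-lower s q))

lt-picked : ∀ {V i R z lo} w → Pick V i R z → Increasing lo V → NotIn w V → lt z w ≡ lt i (rank V w)
lt-picked {v ∷ V} w here (p , q) (v≢w ∷ _) with lt v w in e
... | true = refl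
... | false rewrite rank-below V w (m<n⇒m<1+n (≮∧≢⇒> v≢w (lt-false⁻ {v} {w} e))) q = refl
lt-picked {v ∷ V} {z = z} w (there s) (p , q) (v≢w ∷ ws) with lt v w in e
... | true = lt-picked w s q ws
... | false =
  trans (lt-false {z} {w} (λ z<w → lt-false⁻ {v} {w} e (<-trans (pick-lower s q) z<w)))
        (sym (lt-false (λ i<r → n≮0 (subst (_ <_) w-lowest i<r))))
  where
  w-lowest : rank V w ≡ 0
  w-lowest = rank-below V w (m<n⇒m<1+n (≮∧≢⇒> v≢w (lt-false⁻ {v} {w} e))) q

-- The rank of w after removing the letter of rank i.
skip : ℕ → ℕ → ℕ
skip i j = if lt i j then pred j else j

rank-after-pick : ∀ {V i R z lo} w → Pick V i R z → Increasing lo V → NotIn w V → rank R w ≡ skip i (rank V w)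
rank-after-pick {v ∷ V} w here (p , q) (v≢w ∷ _) with lt v w in e
... | true = refl
... | false rewrite rank-below V w (m<n⇒m<1+n (≮∧≢⇒> v≢w (lt-false⁻ {v} {w} e))) q = refl
rank-after-pick {v ∷ V} {suc i} w (there s) (p , q) (v≢w ∷ ws) with lt v w in e
... | true rewrite rank-after-pick w s q ws with lt i (rank V w) in e'
...   | true = suc-pred _ {{>-nonZero (≤-<-trans z≤n (lt-true⁻ e'))}}
...   | false = refl
rank-after-pick {v ∷ V} {suc i} w (there s) (p , q) (v≢w ∷ ws) | false
  rewrite rank-after-pick w s q ws | rank-below V w (m<n⇒m<1+n (≮∧≢⇒> v≢w (lt-false⁻ {v} {w} e))) q = refl

Σ< : ℕ → (ℕ → ℕ) → ℕ
Σ< zero g = 0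
Σ< (suc k) g = g 0 + Σ< k (λ i → g (suc i))

ΣPick-index : ∀ V (F : List ℕ → ℕ → ℕ) (g : ℕ → ℕ) → (∀ {i R z} → Pick V i R z → F R z ≡ g i) → ΣPick V F ≡ Σ< (length V) g
ΣPick-index [] F g h = refl
ΣPick-index (v ∷ V) F g h = cong₂ _+_ (h here) (ΣPick-index V _ _ (λ p → h (there p)))

-- a ≼ b : a ≤ b, strictly as soon as a is positive.  It is preserved by sums and by
-- scaling, so fiberwise ≼ gives ≼ of the totals.
_≼_ : ℕ → ℕ → Set
a ≼ b = a ≤ b × (0 < a → a < b)

≼-0 : 0 ≼ 0
≼-0 = z≤n , λ ()

≼-+ : ∀ {a b c d} → a ≼ b → c ≼ d → (a + c) ≼ (b + d)
≼-+ {zero} {b} {c} {d} (p₁ , q₁) (p₂ , q₂) = +-mono-≤ p₁ p₂ , λ pos → <-≤-trans (q₂ pos) (m≤n+m d b)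
≼-+ {suc a} {b} {c} {d} (p₁ , q₁) (p₂ , q₂) = +-mono-≤ p₁ p₂ , λ _ → +-mono-<-≤ (q₁ (s≤s z≤n)) p₂

≼-* : ∀ t {a b} → a ≼ b → (t * a) ≼ (t * b)
≼-* zero _ = ≼-0
≼-* (suc t) {a} {b} (p , q) = *-monoʳ-≤ (suc t) p , λ pos → *-monoʳ-< (suc t) (q (factor-positive a pos))
  where
  factor-positive : ∀ a → 0 < suc t * a → 0 < a
  factor-positive zero x rewrite *-zeroʳ t = x
  factor-positive (suc a) x = s≤s z≤n

ΣPick-≼ : ∀ V (F G : List ℕ → ℕ → ℕ) → (∀ {i R z} → Pick V i R z → F R z ≼ G R z) → ΣPick V F ≼ ΣPick V G
ΣPick-≼ [] F G h = ≼-0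
ΣPick-≼ (v ∷ V) F G h = ≼-+ (h here) (ΣPick-≼ V _ _ (λ p → h (there p)))

length-∷ʳ : ∀ (u : List ℕ) y → length (u ++ [ y ]) ≡ suc (length u)
length-∷ʳ u y = trans (length-++ u) (+-comm (length u) 1)

-- Prepend p when β holds (the shape of the recursive step of Defs.peaksFrom).
consIf : Bool → ℕ → List ℕ → List ℕ
consIf β p L = (if β then p ∷_ else (λ l → l)) L

consIf-++ : ∀ β p (A B : List ℕ) → consIf β p (A ++ B) ≡ consIf β p A ++ B
consIf-++ true p A B = refl
consIf-++ false p A B = refl

-- peaks p b x r : the peak positions of the word x ∷ r among x and all letters of r but
-- the last, where x sits at position p and b tells whether the letter before x is smaller.
peaks : ℕ → Bool → ℕ → List ℕ → List ℕ
peaks p b x [] = []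
peaks p b x (z ∷ r) = consIf (b ∧ lt z x) p (peaks (suc p) (lt x z) z r)

lastOf : ℕ → List ℕ → ℕ
lastOf x [] = x
lastOf x (z ∷ r) = lastOf z r

rising : Bool → ℕ → List ℕ → Bool
rising b x [] = b
rising b x (z ∷ r) = rising (lt x z) z r

peakSet-peaks : ∀ x r → peakSet (x ∷ r) ≡ peaks 1 false x r
peakSet-peaks x [] = refl
peakSet-peaks x (y ∷ r) = from 1 x y r
  where
  from : ∀ i y x r → peaksFrom i (y ∷ x ∷ r) ≡ peaks (suc i) (lt y x) x r
  from i y x [] = refl
  from i y x (z ∷ r) = cong (consIf (lt y x ∧ lt z x) (suc i)) (from (suc i) x z r)

peaks-++ : ∀ p b x r s → peaks p b x (r ++ s) ≡ peaks p b x r ++ peaks (p + length r) (rising b x r) (lastOf x r) s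
peaks-++ p b x [] s rewrite +-identityʳ p = refl
peaks-++ p b x (z ∷ r) s rewrite peaks-++ (suc p) (lt x z) z r s | +-suc p (length r) =
  consIf-++ (b ∧ lt z x) p (peaks (suc p) (lt x z) z r) _

lastOf-∷ʳ : ∀ x r y → lastOf x (r ++ [ y ]) ≡ y
lastOf-∷ʳ x [] y = refl
lastOf-∷ʳ x (z ∷ r) y = lastOf-∷ʳ z r y

rising-∷ʳ : ∀ b x r y → rising b x (r ++ [ y ]) ≡ lt (lastOf x r) y
rising-∷ʳ b x [] y = refl
rising-∷ʳ b x (z ∷ r) y = rising-∷ʳ _ z r y

peaks-∷ʳ-max : ∀ H z r → All (_< H) (z ∷ r) → peaks 1 false z (r ++ [ H ]) ≡ peaks 1 false z r
peaks-∷ʳ-max H z r below = begin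
    peaks 1 false z (r ++ [ H ])
  ≡⟨ peaks-++ 1 false z r [ H ] ⟩
    peaks 1 false z r ++ consIf (rising false z r ∧ lt H (lastOf z r)) (1 + length r) []
  ≡⟨ cong (λ β → peaks 1 false z r ++ consIf β (1 + length r) []) no-peak ⟩
    peaks 1 false z r ++ []
  ≡⟨ ++-identityʳ _ ⟩
    peaks 1 false z r
  ∎
  where
  open ≡-Reasoning
  last-below : ∀ z r → All (_< H) (z ∷ r) → lastOf z r < H
  last-below z [] (p ∷ _) = p
  last-below z (z' ∷ r) (_ ∷ ps) = last-below z' r ps
  no-peak : rising false z r ∧ lt H (lastOf z r) ≡ false
  no-peak = trans (cong (rising false z r ∧_) (lt-false (<-asym (last-below z r below)))) (∧-zeroʳ _)

peaks-Increasing : ∀ p b x r → Increasing p (peaks p b x r)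
peaks-Increasing p b x [] = tt
peaks-Increasing p b x (z ∷ r) with b ∧ lt z x
... | true = ≤-refl , peaks-Increasing (suc p) _ z r
... | false = Increasing-weaken _ (n≤1+n p) (peaks-Increasing (suc p) _ z r)

peaks-bounded : ∀ p b x r → All (_< p + length r) (peaks p b x r)
peaks-bounded p b x [] = []
peaks-bounded p b x (z ∷ r) with b ∧ lt z x
... | true rewrite +-suc p (length r) = s≤s (m≤m+n p (length r)) ∷ peaks-bounded (suc p) _ z r
... | false rewrite +-suc p (length r) = peaks-bounded (suc p) _ z r

Increasing-All : ∀ lo L → Increasing lo L → All (lo ≤_) L
Increasing-All lo [] _ = []
Increasing-All lo (q ∷ L) (a , b) = a ∷ All.map (≤-trans (≤-trans a (n≤1+n q))) (Increasing-All (suc q) L b)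

-- partialSums p c : the positions p + c₁, p + c₁ + c₂, …, i.e. the peak set (shifted by p)
-- of permutations whose peak composition starts with c.
partialSums : ℕ → List ℕ → List ℕ
partialSums p [] = []
partialSums p (c ∷ cs) = (p + c) ∷ partialSums (p + c) cs

diffs-partialSums : ∀ p c L n → diffs p (partialSums p c ++ L) n ≡ c ++ diffs (p + sum c) L n
diffs-partialSums p [] L n rewrite +-identityʳ p = refl
diffs-partialSums p (c ∷ cs) L n rewrite m+n∸m≡n p c | diffs-partialSums (p + c) cs L n | +-assoc p c (sum cs) = refl

partialSums-last : ∀ p c → c ≢ [] → ¬ All (_< p + sum c) (partialSums p c)
partialSums-last p [] c≢[] _ = c≢[] refl
partialSums-last p (c ∷ []) _ (q ∷ _) rewrite +-identityʳ c = <-irrefl refl q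
partialSums-last p (c ∷ c₂ ∷ cs) _ (_ ∷ qs) rewrite sym (+-assoc p c (sum (c₂ ∷ cs))) = partialSums-last (p + c) (c₂ ∷ cs) (λ ()) qs

partialSums-∷ʳ : ∀ p (a : List ℕ) aₗ → partialSums p (a ++ [ aₗ ]) ≡ partialSums p a ++ [ p + sum (a ++ [ aₗ ]) ]
partialSums-∷ʳ p [] aₗ rewrite +-identityʳ aₗ = refl
partialSums-∷ʳ p (a ∷ as) aₗ rewrite partialSums-∷ʳ (p + a) as aₗ | +-assoc p a (sum (as ++ [ aₗ ])) = refl

diffs-prefix⁻ : ∀ p L₁ L₂ n c b → Increasing (suc p) L₁ → All (_≤ p + sum c) L₁ → All (p + sum c <_) L₂ →
  c ≢ [] → b ≢ [] → diffs p (L₁ ++ L₂) n ≡ c ++ b → L₁ ≡ partialSums p c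
diffs-prefix⁻ p L₁ L₂ n [] b _ _ _ c≢[] _ _ = ⊥-elim (c≢[] refl)
diffs-prefix⁻ p [] [] n (c ∷ cs) b _ _ _ _ b≢[] e = ⊥-elim (b≢[] (empty cs b (∷-injectiveʳ e)))
  where
  empty : ∀ (cs b : List ℕ) → [] ≡ cs ++ b → b ≡ []
  empty [] b e = sym e
  empty (_ ∷ _) b ()
diffs-prefix⁻ p [] (q ∷ L₂) n (c ∷ cs) b _ _ (q-above ∷ _) _ _ e =
  ⊥-elim (<-irrefl (sym (∷-injectiveˡ e))
    (subst (_< q ∸ p) (m+n∸m≡n p c) (∸-monoˡ-< (≤-<-trans (+-monoʳ-≤ p (m≤m+n c (sum cs))) q-above) (m≤m+n p c))))
diffs-prefix⁻ p (x ∷ L₁) L₂ n (c ∷ cs) b (p<x , inc) (x≤ ∷ xs≤) L₂-above c≢[] b≢[] e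
  with trans (sym (m+[n∸m]≡n (≤-trans (n≤1+n p) p<x))) (cong (p +_) (∷-injectiveˡ e))
... | refl with cs | L₁
...   | [] | [] = refl
...   | [] | y ∷ L₁' = ⊥-elim (<-irrefl refl (≤-trans (proj₁ inc) (subst (y ≤_) (cong (p +_) (+-identityʳ c)) (All.head xs≤))))
...   | c₂ ∷ cs' | L₁' = cong ((p + c) ∷_) (diffs-prefix⁻ (p + c) L₁' L₂ n (c₂ ∷ cs') b inc
          (subst (λ t → All (_≤ t) L₁') (sym (+-assoc p c _)) xs≤)
          (subst (λ t → All (t <_) L₂) (sym (+-assoc p c _)) L₂-above) (λ ()) b≢[] (∷-injectiveʳ e))

diffs-last⁻ : ∀ p Q k c cₗ → Increasing (suc p) Q → diffs p Q k ≡ c ++ [ cₗ ] → Q ≡ partialSums p c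
diffs-last⁻ p [] k [] cₗ _ _ = refl
diffs-last⁻ p [] k (c ∷ cs) cₗ _ e = ⊥-elim (nonempty cs (∷-injectiveʳ e))
  where
  nonempty : ∀ (cs : List ℕ) → [] ≢ cs ++ [ cₗ ]
  nonempty [] ()
  nonempty (_ ∷ _) ()
diffs-last⁻ p (q ∷ []) k [] cₗ _ ()
diffs-last⁻ p (q ∷ _ ∷ _) k [] cₗ _ ()
diffs-last⁻ p (q ∷ Q) k (c ∷ cs) cₗ (p<q , inc) e
  with trans (sym (m+[n∸m]≡n (≤-trans (n≤1+n p) p<q))) (cong (p +_) (∷-injectiveˡ e))
... | refl = cong ((p + c) ∷_) (diffs-last⁻ (p + c) Q k cs cₗ inc (∷-injectiveʳ e))

-- tailComp m y v : the peak composition of the suffix y v of a word in which y sits at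
-- position m + 1 right after a descent, counted from position m.
tailComp : ℕ → ℕ → List ℕ → List ℕ
tailComp m y v = diffs m (peaks (suc m) false y v) (m + suc (length v))

peakSet-split : ∀ w u y v → peakSet (w ∷ u ++ y ∷ v) ≡
  peaks 1 false w (u ++ [ y ]) ++ peaks (suc (suc (length u))) (lt (lastOf w u) y) y v
peakSet-split w u y v = begin
    peakSet (w ∷ u ++ y ∷ v)
  ≡⟨ peakSet-peaks w (u ++ y ∷ v) ⟩
    peaks 1 false w (u ++ y ∷ v)
  ≡⟨ cong (peaks 1 false w) (sym (++-assoc u [ y ] v)) ⟩
    peaks 1 false w ((u ++ [ y ]) ++ v)
  ≡⟨ peaks-++ 1 false w (u ++ [ y ]) v ⟩
    L₁ ++ peaks (suc (length (u ++ [ y ]))) (rising false w (u ++ [ y ])) (lastOf w (u ++ [ y ])) v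
  ≡⟨ cong (λ n → L₁ ++ peaks (suc n) (rising false w (u ++ [ y ])) (lastOf w (u ++ [ y ])) v) (length-∷ʳ u y) ⟩
    L₁ ++ peaks (suc (suc (length u))) (rising false w (u ++ [ y ])) (lastOf w (u ++ [ y ])) v
  ≡⟨ cong₂ (λ b x → L₁ ++ peaks (suc (suc (length u))) b x v) (rising-∷ʳ false w u y) (lastOf-∷ʳ w u y) ⟩
    L₁ ++ peaks (suc (suc (length u))) (lt (lastOf w u) y) y v
  ∎
  where
  open ≡-Reasoning
  L₁ = peaks 1 false w (u ++ [ y ])

-- If the peaks of w u y are the partial sums of c₁ with |w u| = sum c₁, then the last letter
-- of w u is a peak, so y descends from it.
last-peak-descent : ∀ w u y c₁ → c₁ ≢ [] → suc (length u) ≡ sum c₁ →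
  peaks 1 false w (u ++ [ y ]) ≡ partialSums 0 c₁ → lt y (lastOf w u) ≡ true
last-peak-descent w u y c₁ c₁≢[] len e with lt y (lastOf w u) in descent
... | true = refl
... | false = ⊥-elim (partialSums-last 0 c₁ c₁≢[] (subst (All (_< sum c₁)) e (subst (λ t → All (_< t) _) len below)))
  where
  below : All (_< suc (length u)) (peaks 1 false w (u ++ [ y ]))
  below rewrite peaks-++ 1 false w u [ y ] | descent | ∧-zeroʳ (rising false w u)
              | ++-identityʳ (peaks 1 false w u) = peaks-bounded 1 false w u

peakComp-split : ∀ (c₁ c₂ : List ℕ) w u y v → c₁ ≢ [] → c₂ ≢ [] → suc (length u) ≡ sum c₁ →
  δ (peakComp (w ∷ u ++ y ∷ v)) (c₁ ++ c₂) ≡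
    δ (peaks 1 false w (u ++ [ y ])) (partialSums 0 c₁) * δ (tailComp (sum c₁) y v) c₂
peakComp-split c₁ c₂ w u y v c₁≢[] c₂≢[] len = by-cases (≡-dec ℕ._≟_ L₁ (partialSums 0 c₁))
  where
  m = sum c₁
  n = m + suc (length v)
  L₁ = peaks 1 false w (u ++ [ y ])
  L₂ = peaks (suc m) (lt (lastOf w u) y) y v
  peakComp-eq : peakComp (w ∷ u ++ y ∷ v) ≡ diffs 0 (L₁ ++ L₂) n
  peakComp-eq = cong₂ (diffs 0)
    (trans (peakSet-split w u y v) (cong (λ k → L₁ ++ peaks (suc k) (lt (lastOf w u) y) y v) len))
    (trans (cong suc (length-++ u)) (cong (_+ suc (length v)) len))
  by-cases : Dec (L₁ ≡ partialSums 0 c₁) →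
    δ (peakComp (w ∷ u ++ y ∷ v)) (c₁ ++ c₂) ≡ δ L₁ (partialSums 0 c₁) * δ (tailComp m y v) c₂
  by-cases (yes e) = begin
      δ (peakComp (w ∷ u ++ y ∷ v)) (c₁ ++ c₂)
    ≡⟨ cong (λ t → δ t (c₁ ++ c₂)) (trans peakComp-eq (cong (λ L → diffs 0 (L ++ L₂) n) e)) ⟩
      δ (diffs 0 (partialSums 0 c₁ ++ L₂) n) (c₁ ++ c₂)
    ≡⟨ cong (λ t → δ t (c₁ ++ c₂)) (diffs-partialSums 0 c₁ L₂ n) ⟩
      δ (c₁ ++ diffs m L₂ n) (c₁ ++ c₂)
    ≡⟨ δ-++ˡ c₁ _ c₂ ⟩
      δ (diffs m L₂ n) c₂
    ≡⟨ cong (λ b → δ (diffs m (peaks (suc m) b y v) n) c₂)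
            (lt-asym {y} {lastOf w u} (last-peak-descent w u y c₁ c₁≢[] len e)) ⟩
      δ (tailComp m y v) c₂
    ≡⟨ sym (*-identityˡ _) ⟩
      1 * δ (tailComp m y v) c₂
    ≡⟨ cong (_* δ (tailComp m y v) c₂) (sym (δ-≡ e)) ⟩
      δ L₁ (partialSums 0 c₁) * δ (tailComp m y v) c₂
    ∎
    where open ≡-Reasoning
  by-cases (no ne) =
    trans (cong (λ t → δ t (c₁ ++ c₂)) peakComp-eq)
      (trans (δ-≢ (λ e → ne (diffs-prefix⁻ 0 L₁ L₂ n c₁ c₂ (peaks-Increasing 1 false w (u ++ [ y ])) L₁-below L₂-above c₁≢[] c₂≢[] e)))
             (cong (_* δ (tailComp m y v) c₂) (sym (δ-≢ ne))))
    where
    L₁-below : All (_≤ m) L₁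
    L₁-below = All.map ≤-pred (subst (λ t → All (_< suc t) L₁) len
                 (subst (λ t → All (_< suc t) L₁) (length-∷ʳ u y) (peaks-bounded 1 false w (u ++ [ y ]))))
    L₂-above : All (m <_) L₂
    L₂-above = Increasing-All (suc m) L₂ (peaks-Increasing (suc m) _ y v)

peaks-not-ending-at : ∀ w r L → δ (peaks 1 false w r) (L ++ [ suc (length r) ]) ≡ 0
peaks-not-ending-at w r L = δ-≢ (λ e → <-irrefl refl (All.head (AllP.++⁻ʳ L (subst (All (_< suc (length r))) e (peaks-bounded 1 false w r)))))

last-peak-split : ∀ w₀ τ₀ x z a' aₗ → sum (a' ++ [ aₗ ]) ≡ suc (length (τ₀ ++ [ x ])) →
  δ (peaks 1 false w₀ ((τ₀ ++ [ x ]) ++ [ z ])) (partialSums 0 (a' ++ [ aₗ ])) ≡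
  bit (lt (lastOf w₀ τ₀) x ∧ lt z x) * δ (peaks 1 false w₀ τ₀) (partialSums 0 a')
last-peak-split w₀ τ₀ x z a' aₗ sum-a
  rewrite peaks-++ 1 false w₀ (τ₀ ++ [ x ]) [ z ] | partialSums-∷ʳ 0 a' aₗ | sum-a
        | rising-∷ʳ false w₀ τ₀ x | lastOf-∷ʳ w₀ τ₀ x
  with lt (lastOf w₀ τ₀) x in x-rises | lt z x
... | true | true
  rewrite δ-∷ʳ (peaks 1 false w₀ (τ₀ ++ [ x ])) (partialSums 0 a') (1 + length (τ₀ ++ [ x ]))
        | peaks-++ 1 false w₀ τ₀ [ x ] | lt-asym {lastOf w₀ τ₀} {x} x-rises | ∧-zeroʳ (rising false w₀ τ₀)
        | ++-identityʳ (peaks 1 false w₀ τ₀) = sym (+-identityʳ _)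
... | true | false rewrite ++-identityʳ (peaks 1 false w₀ (τ₀ ++ [ x ])) = peaks-not-ending-at w₀ (τ₀ ++ [ x ]) (partialSums 0 a')
... | false | _ rewrite ++-identityʳ (peaks 1 false w₀ (τ₀ ++ [ x ])) = peaks-not-ending-at w₀ (τ₀ ++ [ x ]) (partialSums 0 a')

peaks-shift : ∀ s p b z r → peaks (s + p) b z r ≡ map (s +_) (peaks p b z r)
peaks-shift s p b z [] = refl
peaks-shift s p b z (z' ∷ r) rewrite sym (+-suc s p) | peaks-shift s (suc p) (lt z z') z' r with b ∧ lt z' z
... | true = refl
... | false = refl

diffs-shift : ∀ s p Q k → diffs (s + p) (map (s +_) Q) (s + k) ≡ diffs p Q k
diffs-shift s p [] k rewrite [m+n]∸[m+o]≡n∸o s k p = refl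
diffs-shift s p (q ∷ Q) k rewrite [m+n]∸[m+o]≡n∸o s q p = cong ((q ∸ p) ∷_) (diffs-shift s q Q k)

tailComp-shift : ∀ s z r → tailComp s z r ≡ tailComp 0 z r
tailComp-shift s z r = begin
    diffs s (peaks (suc s) false z r) (s + suc (length r))
  ≡⟨ cong₂ (λ a b → diffs a (peaks b false z r) (s + suc (length r))) (sym (+-identityʳ s)) (sym (+-comm s 1)) ⟩
    diffs (s + 0) (peaks (s + 1) false z r) (s + suc (length r))
  ≡⟨ cong (λ t → diffs (s + 0) t (s + suc (length r))) (peaks-shift s 1 false z r) ⟩
    diffs (s + 0) (map (s +_) (peaks 1 false z r)) (s + suc (length r))
  ≡⟨ diffs-shift s 0 (peaks 1 false z r) (suc (length r)) ⟩
    diffs 0 (peaks 1 false z r) (suc (length r))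
  ∎
  where open ≡-Reasoning

tailComp-last : ∀ s z r c' cₗ → suc (length r) ≡ sum (c' ++ [ cₗ ]) →
  δ (tailComp s z r) (c' ++ [ cₗ ]) ≡ δ (peaks 1 false z r) (partialSums 0 c')
tailComp-last s z r c' cₗ len =
  trans (cong (λ t → δ t (c' ++ [ cₗ ])) (trans (tailComp-shift s z r) (cong (diffs 0 Q) len))) (δ-⇔ to from)
  where
  Q = peaks 1 false z r
  n = sum (c' ++ [ cₗ ])
  to : diffs 0 Q n ≡ c' ++ [ cₗ ] → Q ≡ partialSums 0 c'
  to = diffs-last⁻ 0 Q n c' cₗ (peaks-Increasing 1 false z r)
  last-part : n ∸ sum c' ≡ cₗ
  last-part rewrite sum-++ c' [ cₗ ] | +-identityʳ cₗ = m+n∸m≡n (sum c') cₗ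
  from : Q ≡ partialSums 0 c' → diffs 0 Q n ≡ c' ++ [ cₗ ]
  from e = begin
      diffs 0 Q n
    ≡⟨ cong (λ L → diffs 0 L n) (trans e (sym (++-identityʳ _))) ⟩
      diffs 0 (partialSums 0 c' ++ []) n
    ≡⟨ diffs-partialSums 0 c' [] n ⟩
      c' ++ [ n ∸ sum c' ]
    ≡⟨ cong (λ t → c' ++ [ t ]) last-part ⟩
      c' ++ [ cₗ ]
    ∎
    where open ≡-Reasoning

-- For an increasing R with fresh x, h it only depends on |R|, p, the
-- ranks of x and h in R, whether h < x, and P; `table` tabulates these numbers by recursion
-- on |R|, choosing the letter that follows x.  Targets are the suffixes drop u P of a fixed P.
arrangements : ℕ → Bool → ℕ → List ℕ → ℕ → List ℕ → ℕ
arrangements p b x R h P = ΣPerm R (λ w → δ (peaks p b x (w ++ [ h ])) P)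

nth : ∀ {A : Set} → A → List A → ℕ → A
nth d [] _ = d
nth d (x ∷ xs) zero = x
nth d (x ∷ xs) (suc i) = nth d xs i

-- Tables indexed by u, b, rank of x, rank of h, and h < x.
Table : Set
Table = List (List (List (List (List ℕ))))

entry : Table → ℕ → Bool → ℕ → ℕ → Bool → ℕ
entry t u b jx jh hx = nth 0 (nth [] (nth [] (nth [] (nth [] t u) (bit b)) jx) jh) (bit hx)

booleans : List Bool
booleans = false ∷ true ∷ []

buildTable : ℕ → ℕ → (ℕ → Bool → ℕ → ℕ → Bool → ℕ) → Table
buildTable nu k f =
  map (λ u → map (λ b → map (λ jx → map (λ jh → map (λ hx → f u b jx jh hx)
    booleans) (upTo (suc k))) (upTo (suc k))) booleans) (upTo (suc nu))

nth-applyUpTo : ∀ {A : Set} (d : A) (f : ℕ → A) (g : ℕ → ℕ) n i → i < n → nth d (map f (applyUpTo g n)) i ≡ f (g i)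
nth-applyUpTo d f g (suc n) zero _ = refl
nth-applyUpTo d f g (suc n) (suc i) (s≤s p) = nth-applyUpTo d f (λ x → g (suc x)) n i p

nth-booleans : ∀ {A : Set} (d : A) (f : Bool → A) b → nth d (map f booleans) (bit b) ≡ f b
nth-booleans d f false = refl
nth-booleans d f true = refl

entry-buildTable : ∀ nu k f u b jx jh hx → u ≤ nu → jx ≤ k → jh ≤ k → entry (buildTable nu k f) u b jx jh hx ≡ f u b jx jh hx
entry-buildTable nu k f u b jx jh hx u≤ jx≤ jh≤
  rewrite nth-applyUpTo [] (λ u → map (λ b → map (λ jx → map (λ jh → map (λ hx → f u b jx jh hx) booleans) (upTo (suc k))) (upTo (suc k))) booleans) (λ x → x) (suc nu) u (s≤s u≤)
        | nth-booleans [] (λ b → map (λ jx → map (λ jh → map (λ hx → f u b jx jh hx) booleans) (upTo (suc k))) (upTo (suc k))) b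
        | nth-applyUpTo [] (λ jx → map (λ jh → map (λ hx → f u b jx jh hx) booleans) (upTo (suc k))) (λ x → x) (suc k) jx (s≤s jx≤)
        | nth-applyUpTo [] (λ jh → map (λ hx → f u b jx jh hx) booleans) (λ x → x) (suc k) jh (s≤s jh≤)
        | nth-booleans 0 (λ hx → f u b jx jh hx) hx = refl

entry-cong : ∀ t u {b b' jx jx' jh jh' hx hx'} → b ≡ b' → jx ≡ jx' → jh ≡ jh' → hx ≡ hx' →
  entry t u b jx jh hx ≡ entry t u b' jx' jh' hx'
entry-cong t u refl refl refl refl = refl

expectPeak : ℕ → List ℕ → ℕ → (ℕ → ℕ) → ℕ
expectPeak p P u k with drop u P
... | [] = 0
... | q ∷ _ = if p ≡ᵇ q then k (suc u) else 0

atEnd : List ℕ → ℕ → ℕ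
atEnd P u = bit (length P ≡ᵇ u)

baseEntry : ℕ → List ℕ → ℕ → Bool → ℕ → ℕ → Bool → ℕ
baseEntry m P u b jx jh hx = if b ∧ hx then expectPeak m P u (atEnd P) else atEnd P u

-- The term of the recursion in which the letter following x has rank i: x is a peak iff it
-- was reached by a rise and that letter is smaller; the ranks are updated by `skip`.
stepTerm : ℕ → List ℕ → ℕ → Table → ℕ → Bool → ℕ → ℕ → ℕ → ℕ
stepTerm m P k t u b jx jh i =
  if b ∧ lt i jx
  then expectPeak (m ∸ suc k) P u (λ u' → entry t u' (not (lt i jx)) i (skip i jh) (not (lt i jh)))
  else entry t u (not (lt i jx)) i (skip i jh) (not (lt i jh))

stepEntry : ℕ → List ℕ → ℕ → Table → ℕ → Bool → ℕ → ℕ → Bool → ℕ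
stepEntry m P k t u b jx jh hx = Σ< (suc k) (stepTerm m P k t u b jx jh)

-- The table for |R| = k and starting position m - k.
table : ℕ → List ℕ → ℕ → Table
table m P zero = buildTable (length P) zero (baseEntry m P)
table m P (suc k) = buildTable (length P) (suc k) (stepEntry m P k (table m P k))

drop-∷ : ∀ u (P : List ℕ) {q D} → drop u P ≡ q ∷ D → drop (suc u) P ≡ D
drop-∷ zero (x ∷ P) refl = refl
drop-∷ (suc u) (x ∷ P) e = drop-∷ u P e

drop-nonempty : ∀ u (P : List ℕ) → drop u P ≢ [] → suc u ≤ length P
drop-nonempty zero [] ne = ⊥-elim (ne refl)
drop-nonempty zero (x ∷ P) ne = s≤s z≤n
drop-nonempty (suc u) [] ne = ⊥-elim (ne refl)
drop-nonempty (suc u) (x ∷ P) ne = s≤s (drop-nonempty u P ne)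

δ-drop-∷ : ∀ p L P u → δ (p ∷ L) (drop u P) ≡ expectPeak p P u (λ u' → δ L (drop u' P))
δ-drop-∷ p L P u with drop u P in e
... | [] = refl
... | q ∷ D rewrite drop-∷ u P e = δ-∷ p q L D

δ-drop-[] : ∀ (P : List ℕ) u → u ≤ length P → δ [] (drop u P) ≡ atEnd P u
δ-drop-[] [] zero _ = refl
δ-drop-[] (x ∷ P) zero _ = refl
δ-drop-[] (x ∷ P) (suc u) (s≤s p) = δ-drop-[] P u p

ΣPerm-expectPeak : ∀ R p P u (G : List ℕ → ℕ → ℕ) →
  ΣPerm R (λ w → expectPeak p P u (G w)) ≡ expectPeak p P u (λ u' → ΣPerm R (λ w → G w u'))
ΣPerm-expectPeak R p P u G with drop u P
... | [] = ΣPerm-0 R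
... | q ∷ D with p ≡ᵇ q
...   | true = refl
...   | false = ΣPerm-0 R

expectPeak-cong : ∀ p P u k k' → (drop u P ≢ [] → k (suc u) ≡ k' (suc u)) → expectPeak p P u k ≡ expectPeak p P u k'
expectPeak-cong p P u k k' h with drop u P
... | [] = refl
... | q ∷ D = cong (λ v → if p ≡ᵇ q then v else 0) (h (λ ()))

arrangements-[] : ∀ m P b x h u → u ≤ length P →
  arrangements m b x [] h (drop u P) ≡ entry (table m P 0) u b 0 0 (lt h x)
arrangements-[] m P b x h u u≤ =
  trans (+-identityʳ _)
    (trans (by-cases (b ∧ lt h x)) (sym (entry-buildTable (length P) 0 (baseEntry m P) u b 0 0 (lt h x) u≤ z≤n z≤n)))
  where
  by-cases : ∀ β → δ (consIf β m []) (drop u P) ≡ (if β then expectPeak m P u (atEnd P) else atEnd P u)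
  by-cases true = trans (δ-drop-∷ m [] P u) (expectPeak-cong m P u _ _ (λ ne → δ-drop-[] P (suc u) (drop-nonempty u P ne)))
  by-cases false = δ-drop-[] P u u≤

arrangements-by-rank : ∀ m P k R lo p b x h u → length R ≡ k → p + k ≡ m → Increasing lo R →
  NotIn x R → NotIn h R → u ≤ length P →
  arrangements p b x R h (drop u P) ≡ entry (table m P k) u b (rank R x) (rank R h) (lt h x)
arrangements-by-rank m P zero [] lo p b x h u _ p≡m _ _ _ u≤ with refl ← trans (sym (+-identityʳ p)) p≡m =
  arrangements-[] p P b x h u u≤
arrangements-by-rank m P (suc k) (v ∷ R₀) lo p b x h u len p+k≡m inc x∉ h∉ u≤ =
  trans (ΣPerm-byFirst v R₀ (λ w → δ (peaks p b x (w ++ [ h ])) (drop u P)))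
  (trans (ΣPick-index (v ∷ R₀) _ (stepTerm m P k t u b jx jh) after-pick)
  (trans (cong (λ n → Σ< n (stepTerm m P k t u b jx jh)) len)
  (sym (entry-buildTable (length P) (suc k) (stepEntry m P k t) u b jx jh (lt h x) u≤ (rank-≤ x) (rank-≤ h)))))
  where
  t = table m P k
  jx = rank (v ∷ R₀) x
  jh = rank (v ∷ R₀) h
  rank-≤ : ∀ w → rank (v ∷ R₀) w ≤ suc k
  rank-≤ w = subst (rank (v ∷ R₀) w ≤_) len (rank-≤-length (v ∷ R₀) w)
  p≡ : p ≡ m ∸ suc k
  p≡ = sym (trans (cong (_∸ suc k) (sym p+k≡m)) (m+n∸n≡m p (suc k)))
  -- the letter z of rank i follows x; what remains is an instance of size k
  after-pick : ∀ {i R' z} → Pick (v ∷ R₀) i R' z →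
    ΣPerm R' (λ w → δ (peaks p b x (z ∷ w ++ [ h ])) (drop u P)) ≡ stepTerm m P k t u b jx jh i
  after-pick {i} {R'} {z} s =
    trans (cong (λ β → ΣPerm R' (λ w → δ (consIf β p (peaks (suc p) (lt x z) z (w ++ [ h ]))) (drop u P)))
                (cong (b ∧_) (lt-picked x s inc x∉)))
          (by-cases (b ∧ lt i jx))
    where
    IH : ∀ u' → u' ≤ length P →
      arrangements (suc p) (lt x z) z R' h (drop u' P) ≡ entry t u' (not (lt i jx)) i (skip i jh) (not (lt i jh))
    IH u' u'≤ =
      trans (arrangements-by-rank m P k R' lo (suc p) (lt x z) z h u'
               (suc-injective (trans (sym (pick-length s)) len)) (trans (sym (+-suc p k)) p+k≡m)
               (pick-Increasing s inc) (pick-fresh s inc) (pick-All s h∉) u'≤)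
        (entry-cong t u' (trans (lt-flip (pick-≢ s x∉)) (cong not (lt-picked x s inc x∉))) (rank-picked s inc)
          (rank-after-pick h s inc h∉) (trans (lt-flip (pick-≢ s h∉)) (cong not (lt-picked h s inc h∉))))
    by-cases : ∀ β → ΣPerm R' (λ w → δ (consIf β p (peaks (suc p) (lt x z) z (w ++ [ h ]))) (drop u P)) ≡
      (if β then expectPeak (m ∸ suc k) P u (λ u' → entry t u' (not (lt i jx)) i (skip i jh) (not (lt i jh)))
       else entry t u (not (lt i jx)) i (skip i jh) (not (lt i jh)))
    by-cases true =
      trans (ΣPerm-cong R' (λ w → δ-drop-∷ p (peaks (suc p) (lt x z) z (w ++ [ h ])) P u))
      (trans (ΣPerm-expectPeak R' p P u (λ w u' → δ (peaks (suc p) (lt x z) z (w ++ [ h ])) (drop u' P)))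
      (trans (cong (λ q → expectPeak q P u (λ u' → arrangements (suc p) (lt x z) z R' h (drop u' P))) p≡)
             (expectPeak-cong (m ∸ suc k) P u _ _ (λ ne → IH (suc u) (drop-nonempty u P ne)))))
    by-cases false = IH u u≤

insertions-All : ∀ {Q : ℕ → Set} y τ → Q y → All Q τ →
  All (λ s → All Q s × length s ≡ suc (length τ)) (insertions y τ)
insertions-All y [] qy [] = ((qy ∷ []) , refl) ∷ []
insertions-All y (z ∷ τ) qy (qz ∷ qτ) =
  ((qy ∷ qz ∷ qτ) , refl) ∷ AllP.map⁺ (All.map (λ { (a , e) → (qz ∷ a) , cong suc e }) (insertions-All y τ qy qτ))

perms-All : ∀ {Q : ℕ → Set} L → All Q L → All (λ σ → All Q σ × length σ ≡ length L) (perms L)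
perms-All [] [] = ([] , refl) ∷ []
perms-All (x ∷ xs) (qx ∷ qxs) = AllP.concat⁺ (AllP.map⁺ (All.map
  (λ { {σ} (qσ , lσ) → All.map (λ { (a , e) → a , trans e (cong suc lσ) }) (insertions-All x σ qx qσ) })
  (perms-All xs qxs)))

ΣPerm-cong-on : ∀ {Q : ℕ → Set} L → All Q L → {f g : List ℕ → ℕ} →
  (∀ σ → All Q σ → length σ ≡ length L → f σ ≡ g σ) → ΣPerm L f ≡ ΣPerm L g
ΣPerm-cong-on L qL e = cong sum (map-cong-local (All.map (λ { {σ} (qσ , lσ) → e σ qσ lσ }) (perms-All L qL)))

ΣPerm-byLast-before : ∀ v L ρ (f : List ℕ → ℕ) →
  ΣPerm (v ∷ L) (λ σ → f (σ ++ ρ)) ≡ ΣPick (v ∷ L) (λ R z → ΣPerm R (λ π → f (π ++ z ∷ ρ)))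
ΣPerm-byLast-before v L ρ f =
  trans (ΣPerm-byLast v L (λ σ → f (σ ++ ρ))) (ΣPick-cong (v ∷ L) (λ {_} {R} {z} _ → ΣPerm-cong R (λ π → cong f (++-assoc π [ z ] ρ))))

ΣPerm-byFirst-after : ∀ v L ρ (f : List ℕ → ℕ) →
  ΣPerm (v ∷ L) (λ σ → f (ρ ++ σ)) ≡ ΣPick (v ∷ L) (λ R z → ΣPerm R (λ π → f ((ρ ++ [ z ]) ++ π)))
ΣPerm-byFirst-after v L ρ f =
  trans (ΣPerm-byFirst v L (λ σ → f (ρ ++ σ))) (ΣPick-cong (v ∷ L) (λ {_} {R} {z} _ → ΣPerm-cong R (λ π → cong f (sym (++-assoc ρ [ z ] π)))))

fiber-comparison-prefix : ∀ (Q : ℕ → Set) m (f f' : List ℕ → ℕ) →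
  (∀ V lo y τ → Increasing lo V → length V ≡ m → NotIn y V → All Q V →
     ΣPerm V (λ π → f (π ++ y ∷ τ)) ≼ ΣPerm V (λ π → f' (π ++ y ∷ τ))) →
  ∀ L lo → Increasing lo L → All Q L → m < length L → ΣPerm L f ≼ ΣPerm L f'
fiber-comparison-prefix Q m f f' fibers (v ∷ L) lo inc qL (s≤s m≤|L|) =
  subst₂ _≼_ (sym (trans (ΣPerm-cong (v ∷ L) (λ σ → cong f (sym (++-identityʳ σ)))) (ΣPerm-byLast-before v L [] f)))
          (sym (trans (ΣPerm-cong (v ∷ L) (λ σ → cong f' (sym (++-identityʳ σ)))) (ΣPerm-byLast-before v L [] f')))
    (ΣPick-≼ (v ∷ L) _ _ (λ s → peel (length L ∸ m) _ _ [] (pick-Increasing s inc) (pick-All s qL)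
      (suc-injective (trans (sym (pick-length s)) (cong suc (sym (m+[n∸m]≡n m≤|L|))))) (pick-fresh s inc)))
  where
  -- peel off the last k letters of the first m + k positions, one at a time
  peel : ∀ k R y τ → Increasing lo R → All Q R → length R ≡ m + k → NotIn y R →
    ΣPerm R (λ π → f (π ++ y ∷ τ)) ≼ ΣPerm R (λ π → f' (π ++ y ∷ τ))
  peel zero R y τ inc qR len y∉ = fibers R lo y τ inc (trans len (+-identityʳ m)) y∉ qR
  peel (suc k) [] y τ _ _ len _ = ⊥-elim (0≢1+n (trans len (+-suc m k)))
  peel (suc k) (r ∷ R) y τ inc qR len y∉ =
    subst₂ _≼_ (sym (ΣPerm-byLast-before r R (y ∷ τ) f)) (sym (ΣPerm-byLast-before r R (y ∷ τ) f'))
      (ΣPick-≼ (r ∷ R) _ _ (λ s → peel k _ _ (y ∷ τ) (pick-Increasing s inc) (pick-All s qR)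
        (suc-injective (trans (sym (pick-length s)) (trans len (+-suc m k)))) (pick-fresh s inc)))

fiber-comparison-suffix : ∀ (Q : ℕ → Set) m N (f f' : List ℕ → ℕ) →
  (∀ V lo τ y → Increasing lo V → length V ≡ m → NotIn y V → All Q V → length (τ ++ [ y ]) + m ≡ N →
     ΣPerm V (λ π → f ((τ ++ [ y ]) ++ π)) ≼ ΣPerm V (λ π → f' ((τ ++ [ y ]) ++ π))) →
  ∀ L lo → Increasing lo L → All Q L → m < length L → length L ≡ N → ΣPerm L f ≼ ΣPerm L f'
fiber-comparison-suffix Q m N f f' fibers (v ∷ L) lo inc qL (s≤s m≤|L|) |L|≡N =
  subst₂ _≼_ (sym (ΣPerm-byFirst-after v L [] f)) (sym (ΣPerm-byFirst-after v L [] f'))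
    (ΣPick-≼ (v ∷ L) _ _ (λ s → peel (length L ∸ m) _ [] _ (pick-Increasing s inc) (pick-All s qL)
      (suc-injective (trans (sym (pick-length s)) (cong suc (sym (m+[n∸m]≡n m≤|L|))))) (pick-fresh s inc)
      (trans (sym (pick-length s)) |L|≡N)))
  where
  -- peel off the first k letters of the last m + k positions, one at a time
  peel : ∀ k R τ y → Increasing lo R → All Q R → length R ≡ m + k → NotIn y R → length (τ ++ [ y ]) + length R ≡ N →
    ΣPerm R (λ π → f ((τ ++ [ y ]) ++ π)) ≼ ΣPerm R (λ π → f' ((τ ++ [ y ]) ++ π))
  peel zero R τ y inc qR len y∉ total =
    fibers R lo τ y inc (trans len (+-identityʳ m)) y∉ qR (trans (cong (length (τ ++ [ y ]) +_) (sym (trans len (+-identityʳ m)))) total)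
  peel (suc k) [] τ y _ _ len _ _ = ⊥-elim (0≢1+n (trans len (+-suc m k)))
  peel (suc k) (r ∷ R) τ y inc qR len y∉ total =
    subst₂ _≼_ (sym (ΣPerm-byFirst-after r R (τ ++ [ y ]) f)) (sym (ΣPerm-byFirst-after r R (τ ++ [ y ]) f'))
      (ΣPick-≼ (r ∷ R) _ _ (λ s → peel k _ (τ ++ [ y ]) _ (pick-Increasing s inc) (pick-All s qR)
        (suc-injective (trans (sym (pick-length s)) (trans len (+-suc m k)))) (pick-fresh s inc)
        (trans (moved s) total)))
    where
    moved : ∀ {i R' z} → Pick (r ∷ R) i R' z → length ((τ ++ [ y ]) ++ [ z ]) + length R' ≡ length (τ ++ [ y ]) + length (r ∷ R)
    moved {R' = R'} {z} s rewrite length-++ (τ ++ [ y ]) {[ z ]} | +-assoc (length (τ ++ [ y ])) 1 (length R') =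
      cong (length (τ ++ [ y ]) +_) (sym (pick-length s))

-- A prefix fiber, as a function of the rank j of y: sum over the rank i of the first letter.
prefixFiber : ℕ → Table → ℕ → ℕ
prefixFiber m t j = Σ< m (λ i → entry t 0 false i (skip i j) (not (lt i j)))

-- A suffix fiber, as a function of the rank j of y: sum over the ranks i, i' of the first two
-- letters x, z, which must satisfy y < x > z.
suffixFiber : ℕ → Table → ℕ → ℕ
suffixFiber m t j = Σ< (suc m) (λ i → Σ< m (λ i' → bit (not (lt i j) ∧ lt i' i) * entry t 0 false i' (pred m) false))

ΣPick-arrangements : ∀ k P V lo y → length V ≡ suc k → Increasing lo V → NotIn y V →
  ΣPick V (λ R w → arrangements 1 false w R y P) ≡ prefixFiber (suc k) (table (suc k) P k) (rank V y)
ΣPick-arrangements k P V lo y len inc y∉ =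
  trans (ΣPick-index V _ _ by-rank) (cong (λ n → Σ< n (λ i → entry t 0 false i (skip i j) (not (lt i j)))) len)
  where
  j = rank V y
  t = table (suc k) P k
  by-rank : ∀ {i R w} → Pick V i R w → arrangements 1 false w R y P ≡ entry t 0 false i (skip i j) (not (lt i j))
  by-rank s =
    trans (arrangements-by-rank (suc k) P k _ lo 1 false _ y 0 (suc-injective (trans (sym (pick-length s)) len)) refl
             (pick-Increasing s inc) (pick-fresh s inc) (pick-All s y∉) z≤n)
      (entry-cong t 0 refl (rank-picked s inc) (rank-after-pick y s inc y∉)
        (trans (lt-flip (pick-≢ s y∉)) (cong not (lt-picked y s inc y∉))))

rank-all-below : ∀ H R → All (_< H) R → rank R H ≡ length R
rank-all-below H [] [] = refl
rank-all-below H (v ∷ R) (p ∷ ps) rewrite lt-true p = cong suc (rank-all-below H R ps)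

NotIn-all-below : ∀ H R → All (_< H) R → NotIn H R
NotIn-all-below H R = All.map (λ v<H v≡H → <-irrefl v≡H v<H)

ΣPick-arrangements-max : ∀ k P V lo y H → length V ≡ suc (suc k) → Increasing lo V → NotIn y V → All (_< H) V →
  ΣPick V (λ R x → ΣPick R (λ R' z → bit (lt y x ∧ lt z x) * arrangements 1 false z R' H P)) ≡
  suffixFiber (suc k) (table (suc k) P k) (rank V y)
ΣPick-arrangements-max k P V lo y H len inc y∉ below =
  trans (ΣPick-index V _ _ by-rank) (cong (λ n → Σ< n (λ i → Σ< (suc k) (term i))) len)
  where
  j = rank V y
  t = table (suc k) P k
  term : ℕ → ℕ → ℕ
  term i i' = bit (not (lt i j) ∧ lt i' i) * entry t 0 false i' k false
  by-rank : ∀ {i R x} → Pick V i R x → ΣPick R (λ R' z → bit (lt y x ∧ lt z x) * arrangements 1 false z R' H P) ≡ Σ< (suc k) (term i)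
  by-rank {i} {R} {x} s = trans (ΣPick-index R _ _ by-rank') (cong (λ n → Σ< n (term i)) |R|≡)
    where
    |R|≡ : length R ≡ suc k
    |R|≡ = suc-injective (trans (sym (pick-length s)) len)
    by-rank' : ∀ {i' R' z} → Pick R i' R' z → bit (lt y x ∧ lt z x) * arrangements 1 false z R' H P ≡ term i i'
    by-rank' {i'} {R'} {z} s' = cong₂ _*_
      (cong bit (cong₂ _∧_ (trans (lt-flip (pick-≢ s y∉)) (cong not (lt-picked y s inc y∉)))
                           (trans (lt-picked x s' (pick-Increasing s inc) (pick-fresh s inc)) (cong (lt i') (rank-picked s inc)))))
      (trans (arrangements-by-rank (suc k) P k R' lo 1 false z H 0 |R'|≡ refl (pick-Increasing s' (pick-Increasing s inc))
                (pick-fresh s' (pick-Increasing s inc)) (NotIn-all-below H R' below') z≤n)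
        (entry-cong t 0 refl (rank-picked s' (pick-Increasing s inc)) (trans (rank-all-below H R' below') |R'|≡)
          (lt-false (<-asym (pick-elem s' (pick-All s below))))))
      where
      |R'|≡ : length R' ≡ k
      |R'|≡ = suc-injective (trans (sym (pick-length s')) |R|≡)
      below' : All (_< H) R'
      below' = pick-All s' (pick-All s below)

ΣPerm-byFirst′ : ∀ R f → 0 < length R → ΣPerm R f ≡ ΣPick R (λ R' z → ΣPerm R' (λ σ → f (z ∷ σ)))
ΣPerm-byFirst′ (v ∷ R) f _ = ΣPerm-byFirst v R f

-- A prefix fiber for c ⊕ b: the orders π of V (|V| = |c|) in π y τ.  By `peakComp-split` the
-- tail factor comes out, and the rest is `ΣPick-arrangements` at the rank of y.
prefix-fiber : ∀ c b k V lo y τ → sum c ≡ suc k → c ≢ [] → b ≢ [] → Increasing lo V → length V ≡ suc k → NotIn y V →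
  ΣPerm V (λ π → δ (peakComp (π ++ y ∷ τ)) (c ++ b)) ≡
  δ (tailComp (sum c) y τ) b * prefixFiber (suc k) (table (suc k) (partialSums 0 c) k) (rank V y)
prefix-fiber c b k V lo y τ sum-c c≢[] b≢[] inc len y∉ =
  trans (ΣPerm-byFirst′ V _ (subst (0 <_) (sym len) (s≤s z≤n)))
  (trans (ΣPick-cong V split)
  (trans (ΣPick-* V tail (λ R w → arrangements 1 false w R y (partialSums 0 c)))
  (cong (tail *_) (ΣPick-arrangements k (partialSums 0 c) V lo y len inc y∉))))
  where
  tail = δ (tailComp (sum c) y τ) b
  split : ∀ {i R w} → Pick V i R w →
    ΣPerm R (λ u → δ (peakComp (w ∷ u ++ y ∷ τ)) (c ++ b)) ≡ tail * arrangements 1 false w R y (partialSums 0 c)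
  split {i} {R} {w} s =
    trans (ΣPerm-cong-on {Q = λ _ → ⊤} R (All.universal (λ _ → tt) R)
             (λ u _ |u| → trans (peakComp-split c b w u y τ c≢[] b≢[] (length-u {u} |u|)) (*-comm _ tail)))
          (ΣPerm-* R tail _)
    where
    length-u : ∀ {u : List ℕ} → length u ≡ length R → suc (length u) ≡ sum c
    length-u |u| = trans (cong suc (trans |u| (suc-injective (trans (sym (pick-length s)) len)))) (sym sum-c)

-- A suffix fiber for a ⊕ c with a = a' ++ [ aₗ ], c = c' ++ [ cₗ ]: the orders π = x z π'' of V
-- (|V| = |c| + 1) in w₀ τ₀ π, where τ₀ ends with y (or w₀ = y).  The position of x must be
-- the last peak of a; the prefix factor comes out, and appending a letter H above V turns
-- the rest into arrangements, evaluated by `ΣPick-arrangements-max`.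
suffix-fiber : ∀ a' aₗ c' cₗ k V lo w₀ τ₀ y H → sum (c' ++ [ cₗ ]) ≡ suc k → Increasing lo V → length V ≡ suc (suc k) →
  NotIn y V → All (_< H) V → lastOf w₀ τ₀ ≡ y → suc (suc (length τ₀)) ≡ sum (a' ++ [ aₗ ]) →
  ΣPerm V (λ π → δ (peakComp (w₀ ∷ τ₀ ++ π)) ((a' ++ [ aₗ ]) ++ (c' ++ [ cₗ ]))) ≡
  δ (peaks 1 false w₀ τ₀) (partialSums 0 a') * suffixFiber (suc k) (table (suc k) (partialSums 0 c') k) (rank V y)
suffix-fiber a' aₗ c' cₗ k V lo w₀ τ₀ y H sum-c inc len y∉ below last-y sum-a =
  trans (ΣPerm-byFirst′ V _ (subst (0 <_) (sym len) (s≤s z≤n)))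
  (trans (ΣPick-cong V second-letter)
  (trans (ΣPick-* V head _)
  (cong (head *_) (ΣPick-arrangements-max k P' V lo y H len inc y∉ below))))
  where
  a = a' ++ [ aₗ ]
  c = c' ++ [ cₗ ]
  P' = partialSums 0 c'
  head = δ (peaks 1 false w₀ τ₀) (partialSums 0 a')
  ∷ʳ≢[] : ∀ (xs : List ℕ) x → xs ++ [ x ] ≢ []
  ∷ʳ≢[] [] x ()
  ∷ʳ≢[] (_ ∷ _) x ()
  second-letter : ∀ {i R x} → Pick V i R x →
    ΣPerm R (λ π → δ (peakComp (w₀ ∷ τ₀ ++ x ∷ π)) (a ++ c)) ≡
    head * ΣPick R (λ R' z → bit (lt y x ∧ lt z x) * arrangements 1 false z R' H P')
  second-letter {i} {R} {x} s =
    trans (ΣPerm-byFirst′ R _ (subst (0 <_) (sym |R|≡) (s≤s z≤n))) (trans (ΣPick-cong R rest) (ΣPick-* R head _))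
    where
    |R|≡ : length R ≡ suc k
    |R|≡ = suc-injective (trans (sym (pick-length s)) len)
    rest : ∀ {i' R' z} → Pick R i' R' z →
      ΣPerm R' (λ π → δ (peakComp (w₀ ∷ τ₀ ++ x ∷ z ∷ π)) (a ++ c)) ≡ head * (bit (lt y x ∧ lt z x) * arrangements 1 false z R' H P')
    rest {i'} {R'} {z} s' =
      trans (ΣPerm-cong-on R' below' factor)
        (trans (ΣPerm-* R' head _) (cong (head *_) (ΣPerm-* R' (bit β) (λ w → δ (peaks 1 false z (w ++ [ H ])) P'))))
      where
      below' = pick-All s' (pick-All s below)
      z<H : z < H
      z<H = pick-elem s' (pick-All s below)
      β = lt y x ∧ lt z x
      factor : ∀ π → All (_< H) π → length π ≡ length R' →
        δ (peakComp (w₀ ∷ τ₀ ++ x ∷ z ∷ π)) (a ++ c) ≡ head * (bit β * δ (peaks 1 false z (π ++ [ H ])) P')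
      factor π π-below |π| = begin
          δ (peakComp (w₀ ∷ τ₀ ++ x ∷ z ∷ π)) (a ++ c)
        ≡⟨ cong (λ σ → δ (peakComp (w₀ ∷ σ)) (a ++ c)) (sym (++-assoc τ₀ [ x ] (z ∷ π))) ⟩
          δ (peakComp (w₀ ∷ (τ₀ ++ [ x ]) ++ z ∷ π)) (a ++ c)
        ≡⟨ peakComp-split a c w₀ (τ₀ ++ [ x ]) z π (∷ʳ≢[] a' aₗ) (∷ʳ≢[] c' cₗ) (trans (cong suc (length-∷ʳ τ₀ x)) sum-a) ⟩
          δ (peaks 1 false w₀ ((τ₀ ++ [ x ]) ++ [ z ])) (partialSums 0 a) * δ (tailComp (sum a) z π) c
        ≡⟨ cong₂ _*_ (last-peak-split w₀ τ₀ x z a' aₗ (trans (sym sum-a) (cong suc (sym (length-∷ʳ τ₀ x)))))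
                     (tailComp-last (sum a) z π c' cₗ (trans (cong suc (trans |π| |R'|≡)) (sym sum-c))) ⟩
          (bit (lt (lastOf w₀ τ₀) x ∧ lt z x) * head) * δ (peaks 1 false z π) P'
        ≡⟨ cong (λ q → (bit (lt q x ∧ lt z x) * head) * δ (peaks 1 false z π) P') last-y ⟩
          (bit β * head) * δ (peaks 1 false z π) P'
        ≡⟨ cong (λ L → (bit β * head) * δ L P') (sym (peaks-∷ʳ-max H z π (z<H ∷ π-below))) ⟩
          (bit β * head) * δ (peaks 1 false z (π ++ [ H ])) P'
        ≡⟨ trans (cong (_* rest') (*-comm (bit β) head)) (*-assoc head (bit β) rest') ⟩
          head * (bit β * δ (peaks 1 false z (π ++ [ H ])) P')
        ∎
        where
        open ≡-Reasoning
        rest' = δ (peaks 1 false z (π ++ [ H ])) P'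
        |R'|≡ : length R' ≡ k
        |R'|≡ = suc-injective (trans (sym (pick-length s')) |R|≡)

length-filter : ∀ {A : Set} {Q : A → Set} (d : (a : A) → Dec (Q a)) xs → length (filter d xs) ≡ sum (map (λ a → 𝟙 (d a)) xs)
length-filter d [] = refl
length-filter d (x ∷ xs) with d x
... | yes _ = cong suc (length-filter d xs)
... | no _ = length-filter d xs

letters : ℕ → List ℕ
letters n = map suc (upTo n)

P-ΣPerm : ∀ c → P c ≡ ΣPerm (letters (sum c)) (λ σ → δ (peakComp σ) c)
P-ΣPerm c = length-filter (λ σ → ≡-dec ℕ._≟_ (peakComp σ) c) (perms (letters (sum c)))

letters-applyUpTo : ∀ n → letters n ≡ applyUpTo suc n
letters-applyUpTo n = map-applyUpTo (λ i → i) suc n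

Increasing-applyUpTo : ∀ n (f : ℕ → ℕ) lo → lo ≤ f 0 → (∀ i → f i < f (suc i)) → Increasing lo (applyUpTo f n)
Increasing-applyUpTo zero f lo _ _ = tt
Increasing-applyUpTo (suc n) f lo p q = p , Increasing-applyUpTo n (λ i → f (suc i)) (suc (f 0)) (q 0) (λ i → q (suc i))

below-applyUpTo : ∀ n (f : ℕ → ℕ) H → (∀ i → i < n → f i < H) → All (_< H) (applyUpTo f n)
below-applyUpTo zero f H _ = []
below-applyUpTo (suc n) f H h = h 0 (s≤s z≤n) ∷ below-applyUpTo n (λ i → f (suc i)) H (λ i p → h (suc i) (s≤s p))

letters-Increasing : ∀ n → Increasing 0 (letters n)
letters-Increasing n rewrite letters-applyUpTo n = Increasing-applyUpTo n suc 0 z≤n (λ i → ≤-refl)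

letters-below : ∀ n → All (_< suc n) (letters n)
letters-below n rewrite letters-applyUpTo n = below-applyUpTo n suc (suc n) (λ i p → s≤s p)

letters-length : ∀ n → length (letters n) ≡ n
letters-length n rewrite letters-applyUpTo n = length-applyUpTo suc n

perms-first : ∀ (L : List ℕ) → Σ[ r ∈ List (List ℕ) ] perms L ≡ L ∷ r
perms-first [] = [] , refl
perms-first (x ∷ xs) with perms-first xs
... | r , e rewrite e = insertion-first xs
  where
  insertion-first : ∀ (xs : List ℕ) → Σ[ r' ∈ List (List ℕ) ] insertions x xs ++ concatMap (insertions x) r ≡ (x ∷ xs) ∷ r'
  insertion-first [] = _ , refl
  insertion-first (y ∷ ys) = _ , refl

Increasing-no-peaks : ∀ i lo L → Increasing lo L → peaksFrom i L ≡ []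
Increasing-no-peaks i lo [] _ = refl
Increasing-no-peaks i lo (x ∷ []) _ = refl
Increasing-no-peaks i lo (x ∷ y ∷ []) _ = refl
Increasing-no-peaks i lo (x ∷ y ∷ z ∷ r) (p , q , y<z , rest) =
  trans (cong (λ β → consIf β (suc i) (peaksFrom (suc i) (y ∷ z ∷ r)))
              (trans (cong (lt x y ∧_) (lt-false {z} {y} (<-asym y<z))) (∧-zeroʳ _)))
        (Increasing-no-peaks (suc i) (suc x) (y ∷ z ∷ r) (q , y<z , rest))

-- The identity permutation has peak composition (n).
P-single : ∀ n → 1 ≤ P [ n ]
P-single n rewrite P-ΣPerm [ n ] | +-identityʳ n with perms-first (letters n)
... | r , e rewrite e | Increasing-no-peaks 1 0 (letters n) (letters-Increasing n) | letters-length n | δ-≡ {[ n ]} refl = s≤s z≤n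

sum-positive : ∀ b → IsComposition b → b ≢ [] → 0 < sum b
sum-positive [] _ b≢[] = ⊥-elim (b≢[] refl)
sum-positive (b ∷ bs) (p ∷ _) _ = <-≤-trans p (m≤m+n b (sum bs))

-- If P x ≼ P d for a composition d of the same positive size, x is not maximal: for P x > 0
-- the inequality is strict, and for P x = 0 the one-part composition beats x.
not-maximal : ∀ x d → IsComposition d → sum d ≡ sum x → 0 < sum x → P x ≼ P d → ¬ Maximal x
not-maximal x d d-comp same pos (_ , strict) max = by-cases (P x) refl
  where
  by-cases : ∀ q → P x ≡ q → ⊥
  by-cases zero e = 1+n≰n (≤-trans (P-single (sum x)) (subst (P [ sum x ] ≤_) e (max [ sum x ] (pos ∷ []) (+-identityʳ _))))
  by-cases (suc q) e = <-irrefl refl (<-≤-trans (strict (subst (0 <_) (sym e) (s≤s z≤n))) (max d d-comp same))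

P-≼ : ∀ x d → sum d ≡ sum x →
  ΣPerm (letters (sum x)) (λ σ → δ (peakComp σ) x) ≼ ΣPerm (letters (sum x)) (λ σ → δ (peakComp σ) d) → P x ≼ P d
P-≼ x d same = subst₂ _≼_ (sym (P-ΣPerm x)) (sym (trans (P-ΣPerm d) (cong (λ n → ΣPerm (letters n) (λ σ → δ (peakComp σ) d)) same)))

_≼ᵇ_ : ℕ → ℕ → Bool
a ≼ᵇ b = (a ≤ᵇ b) ∧ ((a ≡ᵇ 0) ∨ (a <ᵇ b))

pointwise≼ᵇ : ℕ → (ℕ → ℕ) → (ℕ → ℕ) → Bool
pointwise≼ᵇ zero g g' = g 0 ≼ᵇ g' 0
pointwise≼ᵇ (suc n) g g' = (g (suc n) ≼ᵇ g' (suc n)) ∧ pointwise≼ᵇ n g g'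

≼ᵇ-sound : ∀ a b → T (a ≼ᵇ b) → a ≼ b
≼ᵇ-sound a b h with a ≤ᵇ b in e₁ | a ≡ᵇ 0 in e₂ | a <ᵇ b in e₃
... | true | true | _ = ≤ᵇ⇒≤ a b (subst T (sym e₁) tt) , λ pos → ⊥-elim (<-irrefl (sym (≡ᵇ⇒≡ a 0 (subst T (sym e₂) tt))) pos)
... | true | false | true = ≤ᵇ⇒≤ a b (subst T (sym e₁) tt) , λ _ → <ᵇ⇒< a b (subst T (sym e₃) tt)

pointwise≼ᵇ-sound : ∀ n g g' → T (pointwise≼ᵇ n g g') → ∀ j → j ≤ n → g j ≼ g' j
pointwise≼ᵇ-sound zero g g' h zero _ = ≼ᵇ-sound _ _ h
pointwise≼ᵇ-sound (suc n) g g' h j j≤ with Equivalence.to T-∧ h | m≤n⇒m<n∨m≡n j≤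
... | _ , rest | inj₁ j<1+n = pointwise≼ᵇ-sound n g g' rest j (≤-pred j<1+n)
... | top , _ | inj₂ refl = ≼ᵇ-sound _ _ top

prefix-not-maximal : ∀ c c' k → sum c ≡ suc k → sum c' ≡ suc k → c ≢ [] → c' ≢ [] → IsComposition c' →
  T (pointwise≼ᵇ (suc k) (prefixFiber (suc k) (table (suc k) (partialSums 0 c) k))
                          (prefixFiber (suc k) (table (suc k) (partialSums 0 c') k))) →
  ∀ b → IsComposition b → b ≢ [] → ¬ Maximal (c ++ b)
prefix-not-maximal c c' k sum-c sum-c' c≢[] c'≢[] c'-comp check b b-comp b≢[] =
  not-maximal (c ++ b) (c' ++ b) (AllP.++⁺ c'-comp b-comp) same-size (subst (0 <_) (sym n≡) (s≤s z≤n))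
    (P-≼ (c ++ b) (c' ++ b) same-size
      (fiber-comparison-prefix (λ _ → ⊤) (suc k) _ _ fibers (letters n) 0 (letters-Increasing n) (All.universal (λ _ → tt) _)
        (subst (suc k <_) (sym (trans (letters-length n) n≡)) (m<m+n (suc k) (sum-positive b b-comp b≢[])))))
  where
  n = sum (c ++ b)
  n≡ : n ≡ suc k + sum b
  n≡ = trans (sum-++ c b) (cong (_+ sum b) sum-c)
  same-size : sum (c' ++ b) ≡ n
  same-size = trans (sum-++ c' b) (trans (cong (_+ sum b) (trans sum-c' (sym sum-c))) (sym (sum-++ c b)))
  fiber : ∀ d → sum d ≡ suc k → d ≢ [] → ∀ V lo y τ → Increasing lo V → length V ≡ suc k → NotIn y V →
    ΣPerm V (λ π → δ (peakComp (π ++ y ∷ τ)) (d ++ b)) ≡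
    δ (tailComp (suc k) y τ) b * prefixFiber (suc k) (table (suc k) (partialSums 0 d) k) (rank V y)
  fiber d sum-d d≢[] V lo y τ inc |V| y∉ =
    trans (prefix-fiber d b k V lo y τ sum-d d≢[] b≢[] inc |V| y∉) (cong (λ m → δ (tailComp m y τ) b * prefixFiber (suc k) (table (suc k) (partialSums 0 d) k) (rank V y)) sum-d)
  fibers : ∀ V lo y τ → Increasing lo V → length V ≡ suc k → NotIn y V → All (λ _ → ⊤) V →
    ΣPerm V (λ π → δ (peakComp (π ++ y ∷ τ)) (c ++ b)) ≼ ΣPerm V (λ π → δ (peakComp (π ++ y ∷ τ)) (c' ++ b))
  fibers V lo y τ inc |V| y∉ _ =
    subst₂ _≼_ (sym (fiber c sum-c c≢[] V lo y τ inc |V| y∉)) (sym (fiber c' sum-c' c'≢[] V lo y τ inc |V| y∉))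
      (≼-* (δ (tailComp (suc k) y τ) b)
        (pointwise≼ᵇ-sound (suc k) _ _ check (rank V y) (subst (rank V y ≤_) |V| (rank-≤-length V y))))

-- Position 1 is never a peak, so no peak composition is 1 followed by further parts.
peakComp-≢-1∷ : ∀ σ (c : List ℕ) → c ≢ [] → peakComp σ ≢ 1 ∷ c
peakComp-≢-1∷ [] c c≢[] ()
peakComp-≢-1∷ (w ∷ r) c c≢[] e with peaksFrom 1 (w ∷ r) | peakSet-peaks w r
... | [] | _ = c≢[] (sym (∷-injectiveʳ e))
... | q ∷ Q | peaks≡ with subst (Increasing 2) (sym peaks≡) (after-start w r)
  where
  after-start : ∀ x r → Increasing 2 (peaks 1 false x r)
  after-start x [] = tt
  after-start x (z ∷ r) = peaks-Increasing 2 _ z r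
...   | 2≤q , _ = <-irrefl (sym (∷-injectiveˡ e)) 2≤q

size-one : ∀ a → IsComposition a → sum a ≡ 1 → a ≡ [ 1 ]
size-one [] _ ()
size-one (x ∷ []) _ e = cong [_] (trans (sym (+-identityʳ x)) e)
size-one (x ∷ y ∷ as) (0<x ∷ 0<y ∷ _) e =
  ⊥-elim (<-irrefl (sym e) (<-≤-trans (+-mono-≤ 0<x 0<y) (+-monoʳ-≤ x (m≤m+n y (sum as)))))

∷ʳ-from-first : ∀ (τ : List ℕ) y → Σ[ w₀ ∈ ℕ ] Σ[ τ₀ ∈ List ℕ ] (τ ++ [ y ] ≡ w₀ ∷ τ₀) × lastOf w₀ τ₀ ≡ y
∷ʳ-from-first [] y = y , [] , refl , refl
∷ʳ-from-first (t ∷ τ) y = t , τ ++ [ y ] , refl , lastOf-∷ʳ t τ y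

-- Suffix criterion: if c ++ [ cₗ ] and d ++ [ dₗ ] have the same size and, at every rank, the
-- suffix fiber of c is ≼ that of d, then a ⊕ c ++ [ cₗ ] is not maximal for any nonempty
-- composition a.  (For |a| = 1 its count is 0, as position 1 is never a peak.)
suffix-not-maximal : ∀ c cₗ d dₗ k → sum (c ++ [ cₗ ]) ≡ suc k → sum (d ++ [ dₗ ]) ≡ suc k → IsComposition (d ++ [ dₗ ]) →
  T (pointwise≼ᵇ (suc (suc k)) (suffixFiber (suc k) (table (suc k) (partialSums 0 c) k))
                                (suffixFiber (suc k) (table (suc k) (partialSums 0 d) k))) →
  ∀ a → IsComposition a → a ≢ [] → ¬ Maximal (a ++ (c ++ [ cₗ ]))
suffix-not-maximal c cₗ d dₗ k sum-c sum-d d-comp check a a-comp a≢[] with initLast a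
... | [] = ⊥-elim (a≢[] refl)
... | a' ∷ʳ′ aₗ = by-size (sum A) refl (sum-positive A a-comp a≢[])
  where
  A = a' ++ [ aₗ ]
  C = c ++ [ cₗ ]
  D = d ++ [ dₗ ]
  N = sum (A ++ C)
  N≡ : N ≡ sum A + suc k
  N≡ = trans (sum-++ A C) (cong (sum A +_) sum-c)
  same-size : sum (A ++ D) ≡ N
  same-size = trans (sum-++ A D) (trans (cong (sum A +_) (trans sum-d (sym sum-c))) (sym (sum-++ A C)))
  compare : P (A ++ C) ≼ P (A ++ D) → ¬ Maximal (A ++ C)
  compare = not-maximal (A ++ C) (A ++ D) (AllP.++⁺ a-comp d-comp) same-size
              (subst (0 <_) (sym N≡) (≤-trans (s≤s z≤n) (m≤n+m (suc k) (sum A))))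
  fibers : ∀ V lo τ y → Increasing lo V → length V ≡ suc (suc k) → NotIn y V → All (_< suc N) V →
    length (τ ++ [ y ]) + suc (suc k) ≡ N →
    ΣPerm V (λ π → δ (peakComp ((τ ++ [ y ]) ++ π)) (A ++ C)) ≼ ΣPerm V (λ π → δ (peakComp ((τ ++ [ y ]) ++ π)) (A ++ D))
  fibers V lo τ y inc |V| y∉ below total with ∷ʳ-from-first τ y
  ... | w₀ , τ₀ , e , last-y rewrite e =
    subst₂ _≼_ (sym (suffix-fiber a' aₗ c cₗ k V lo w₀ τ₀ y (suc N) sum-c inc |V| y∉ below last-y |A|))
            (sym (suffix-fiber a' aₗ d dₗ k V lo w₀ τ₀ y (suc N) sum-d inc |V| y∉ below last-y |A|))
      (≼-* (δ (peaks 1 false w₀ τ₀) (partialSums 0 a'))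
        (pointwise≼ᵇ-sound (suc (suc k)) (suffixFiber (suc k) (table (suc k) (partialSums 0 c) k))
          (suffixFiber (suc k) (table (suc k) (partialSums 0 d) k)) check (rank V y) (subst (rank V y ≤_) |V| (rank-≤-length V y))))
    where
    |A| : suc (suc (length τ₀)) ≡ sum A
    |A| = +-cancelʳ-≡ (suc k) _ _ (trans (sym (+-suc (suc (length τ₀)) (suc k))) (trans total N≡))
  by-size : ∀ s → sum A ≡ s → 0 < s → ¬ Maximal (A ++ C)
  by-size (suc zero) |A|≡1 _ = compare (subst₂ _≼_ (sym P≡0) refl (z≤n , λ ()))
    where
    P≡0 : P (A ++ C) ≡ 0
    P≡0 = trans (P-ΣPerm (A ++ C))
      (trans (ΣPerm-cong (letters N) (λ σ → δ-≢ (λ e → peakComp-≢-1∷ σ C (∷ʳ≢[] c) (trans e (cong (_++ C) (size-one A a-comp |A|≡1))))))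
             (ΣPerm-0 (letters N)))
      where
      ∷ʳ≢[] : ∀ (xs : List ℕ) → xs ++ [ cₗ ] ≢ []
      ∷ʳ≢[] [] ()
      ∷ʳ≢[] (_ ∷ _) ()
  by-size (suc (suc s)) |A|≡ _ =
    compare (P-≼ (A ++ C) (A ++ D) same-size
      (fiber-comparison-suffix (_< suc N) (suc (suc k)) N _ _ fibers (letters N) 0 (letters-Increasing N) (letters-below N)
        (subst (suc (suc k) <_) (sym (trans (letters-length N) N≡)) (+-monoˡ-≤ (suc k) (subst (2 ≤_) (sym |A|≡) (s≤s (s≤s z≤n)))))
        (letters-length N)))

positive : ∀ {n} → 0 < suc n
positive = s≤s z≤n

prefix-cases : (b : List ℕ) → IsComposition b → b ≢ [] →
    (c : List ℕ) →
    c ∈ ((4 ∷ 3 ∷ 2 ∷ []) ∷ (4 ∷ 3 ∷ 4 ∷ []) ∷ (3 ∷ 2 ∷ 3 ∷ 2 ∷ [])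
    ∷ (3 ∷ 3 ∷ 2 ∷ 3 ∷ 2 ∷ []) ∷ []) →
    ¬ Maximal (c ++ b)
prefix-cases b b-comp b≢[] c (Any.here refl) =
  prefix-not-maximal (4 ∷ 3 ∷ 2 ∷ []) (3 ∷ 3 ∷ 3 ∷ []) 8 refl refl (λ ()) (λ ())
    (positive ∷ positive ∷ positive ∷ []) tt b b-comp b≢[]
prefix-cases b b-comp b≢[] c (Any.there (Any.here refl)) =
  prefix-not-maximal (4 ∷ 3 ∷ 4 ∷ []) (3 ∷ 2 ∷ 3 ∷ 3 ∷ []) 10 refl refl (λ ()) (λ ())
    (positive ∷ positive ∷ positive ∷ positive ∷ []) tt b b-comp b≢[]
prefix-cases b b-comp b≢[] c (Any.there (Any.there (Any.here refl))) =
  prefix-not-maximal (3 ∷ 2 ∷ 3 ∷ 2 ∷ []) (4 ∷ 3 ∷ 3 ∷ []) 9 refl refl (λ ()) (λ ())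
    (positive ∷ positive ∷ positive ∷ []) tt b b-comp b≢[]
prefix-cases b b-comp b≢[] c (Any.there (Any.there (Any.there (Any.here refl)))) =
  prefix-not-maximal (3 ∷ 3 ∷ 2 ∷ 3 ∷ 2 ∷ []) (4 ∷ 3 ∷ 3 ∷ 3 ∷ []) 12 refl refl (λ ()) (λ ())
    (positive ∷ positive ∷ positive ∷ positive ∷ []) tt b b-comp b≢[]

suffix-cases : (a : List ℕ) → IsComposition a → a ≢ [] →
    (c : List ℕ) →
    c ∈ ((2 ∷ 3 ∷ 3 ∷ []) ∷ (4 ∷ 3 ∷ 3 ∷ []) ∷ (2 ∷ 3 ∷ 2 ∷ 2 ∷ [])
    ∷ (2 ∷ 3 ∷ 2 ∷ 3 ∷ 2 ∷ []) ∷ []) →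
    ¬ Maximal (a ++ c)
suffix-cases a a-comp a≢[] c (Any.here refl) =
  suffix-not-maximal (2 ∷ 3 ∷ []) 3 (3 ∷ 3 ∷ []) 2 7 refl refl
    (positive ∷ positive ∷ positive ∷ []) tt a a-comp a≢[]
suffix-cases a a-comp a≢[] c (Any.there (Any.here refl)) =
  suffix-not-maximal (4 ∷ 3 ∷ []) 3 (3 ∷ 2 ∷ 3 ∷ []) 2 9 refl refl
    (positive ∷ positive ∷ positive ∷ positive ∷ []) tt a a-comp a≢[]
suffix-cases a a-comp a≢[] c (Any.there (Any.there (Any.here refl))) =
  suffix-not-maximal (2 ∷ 3 ∷ 2 ∷ []) 2 (3 ∷ 3 ∷ []) 3 8 refl refl
    (positive ∷ positive ∷ positive ∷ []) tt a a-comp a≢[]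
suffix-cases a a-comp a≢[] c (Any.there (Any.there (Any.there (Any.here refl)))) =
  suffix-not-maximal (2 ∷ 3 ∷ 2 ∷ 3 ∷ []) 2 (3 ∷ 3 ∷ 3 ∷ []) 3 11 refl refl
    (positive ∷ positive ∷ positive ∷ positive ∷ []) tt a a-comp a≢[]

lemma4p3 : ((b : List ℕ) → IsComposition b → b ≢ [] →
    (c : List ℕ) →
    c ∈ ((4 ∷ 3 ∷ 2 ∷ []) ∷ (4 ∷ 3 ∷ 4 ∷ []) ∷ (3 ∷ 2 ∷ 3 ∷ 2 ∷ [])
    ∷ (3 ∷ 3 ∷ 2 ∷ 3 ∷ 2 ∷ []) ∷ []) →
    ¬ Maximal (c ++ b))
    × ((a : List ℕ) → IsComposition a → a ≢ [] →
    (c : List ℕ) →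
    c ∈ ((2 ∷ 3 ∷ 3 ∷ []) ∷ (4 ∷ 3 ∷ 3 ∷ []) ∷ (2 ∷ 3 ∷ 2 ∷ 2 ∷ [])
    ∷ (2 ∷ 3 ∷ 2 ∷ 3 ∷ 2 ∷ []) ∷ []) →
    ¬ Maximal (a ++ c))
lemma4p3 = prefix-cases , suffix-cases
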